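{- Let $\sigma, \tau \in S_n$ such that $\sigma^{\mathsf{CT}} \neq \tau^{\mathsf{CT}}$. Let $\omega$ and $\pi$ be the cycles in the disjoint cycle decomposition of $\sigma^{ -1}\tau$ which contain $n-1$ and $\sigma(n-1)$, respectively (a cycle being the identity $(0)$ if the corresponding symbol is fixed). Suppose that $\sigma^{ -1}\tau = \rho\,\omega\,\pi$ if $\omega\neq\pi$ and $\sigma^{ -1}\tau=\rho\,\omega$ if $\omega=\pi$, where $\rho \in S_n$ is disjoint from $\omega$ and $\pi$. Then $\big(\sigma^{\mathsf{CT}}\big)^{ -1}\tau^{\mathsf{CT}} = \rho\,\chi$ for some $\chi \in S_{n-1}$ disjoint from $\rho$, and the following hold. (1) If ${\rm hd}\big(\sigma^{\mathsf{CT}},\tau^{\mathsf{CT}}\big) = {\rm hd}(\sigma, \tau)$, then either $\omega = (0)$ or $\pi = (0)$, and $\chi$ is a cycle with $|\chi| = |\omega\,\pi|$. (2) Suppose that ${\rm hd}\big(\sigma^{\mathsf{CT}},\tau^{\mathsf{CT}}\big) = {\rm hd}(\sigma,\tau) - 1$. (a) If $\omega = \pi$ then either $\chi$ is a cycle with $|\chi| = |\omega| - 1$, or $\chi$ is a product of two disjoint cycles $\omega'$ and $\pi'$ with $|\omega'| + |\pi'| = |\omega| - 1$. (b) If $\omega \neq \pi$ then $\chi$ is a cycle with $|\chi| = |\omega| + |\pi| - 1$. (3) If ${\rm hd}\big(\sigma^{\mathsf{CT}},\tau^{\mathsf{CT}}\big) = {\rm hd}(\sigma,\tau) - 2$, then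 $\omega = \pi$ and $\chi$ is a cycle with $|\chi| = |\omega| - 2$. (4) If ${\rm hd}\big(\sigma^{\mathsf{CT}},\tau^{\mathsf{CT}}\big) = {\rm hd}(\sigma,\tau) - 3$, then $\omega = \pi$, $|\omega| = 3$, and $\chi = (0)$.
   Context: $S_n$ is the symmetric group on $\{0,1,\ldots,n-1\}$; $S_{n-1}$ acts on $\{0,\ldots,n-2\}$. Permutations are composed from left to right: $\tau\sigma(x):=\sigma(\tau(x))$, so $\sigma^{ -1}\tau(x)=\tau(\sigma^{ -1}(x))$. The Hamming distance is ${\rm hd}(\sigma,\tau)=|\{x: \sigma(x)\neq\tau(x)\}|$. The contraction of $\sigma\in S_n$ is the permutation $\sigma^{\mathsf{CT}}\in S_{n-1}$ defined by $\sigma^{\mathsf{CT}}(x)=\sigma(n-1)$ if $x=\sigma^{ -1}(n-1)$ and $\sigma^{\mathsf{CT}}(x)=\sigma(x)$ otherwise (i.e. delete $n-1$ from the cycle notation of $\sigma$). $|\rho|$ denotes the length of a cycle $\rho$ (number of symbols moved); the identity $(0)$ has length zero, and a symbol fixed by a permutation is said to belong to a cycle of zero length in its disjoint cycle decomposition. -}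

module Defs where

open import Data.Nat.Base using (ℕ; zero; suc)
open import Data.Fin.Base using (Fin; zero; suc; fromℕ; inject₁; punchIn; punchOut)
import Data.Fin.Base
open import Data.Fin.Properties using (_≟_)
import Data.Fin.Properties
open import Data.Empty using (⊥-elim)
open import Data.Fin.Permutation public
  using (Permutation′; _⟨$⟩ʳ_; _⟨$⟩ˡ_; _∘ₚ_; flip; id; transpose; remove; inverseʳ)
import Data.Fin.Permutation.Components as PC
open import Data.List.Base using (List; length; filter; allFin)
open import Data.Product.Base using (∃; _,_)
open import Data.Sum.Base using (_⊎_)
open import Relation.Nullary using (¬_; yes; no; ¬?)
open import Relation.Nullary.Decidable using (dec-true; dec-false)
open import Relation.Binary.PropositionalEquality
  using (_≡_; _≢_; refl; sym; trans; cong)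

-- Products are composed from LEFT TO RIGHT,
-- as in the paper:  (σ · τ)(x) = τ (σ x).  The stdlib's _∘ₚ_ already
-- has this convention: (π₁ ∘ₚ π₂) ⟨$⟩ʳ x = π₂ ⟨$⟩ʳ (π₁ ⟨$⟩ʳ x).

S : ℕ → Set
S = Permutation′

infixl 7 _·_
_·_ : ∀ {n} → S n → S n → S n
σ · τ = σ ∘ₚ τ

_⁻¹ : ∀ {n} → S n → S n
σ ⁻¹ = flip σ

infix 4 _≈_
_≈_ : ∀ {n} → S n → S n → Set
σ ≈ τ = ∀ x → σ ⟨$⟩ʳ x ≡ τ ⟨$⟩ʳ x

iter : ∀ {A : Set} → (A → A) → ℕ → A → A
iter f zero    a = a
iter f (suc k) a = f (iter f k a)

hd : ∀ {n} → S n → S n → ℕ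
hd {n} σ τ = length (filter (λ x → ¬? ((σ ⟨$⟩ʳ x) ≟ (τ ⟨$⟩ʳ x))) (allFin n))

∣_∣ : ∀ {n} → S n → ℕ
∣_∣ {n} ρ = length (filter (λ x → ¬? ((ρ ⟨$⟩ʳ x) ≟ x)) (allFin n))

Moves : ∀ {n} → S n → Fin n → Set
Moves ρ x = ρ ⟨$⟩ʳ x ≢ x

-- ρ is a cycle: all moved symbols lie in one orbit of ρ.
-- The identity (0) counts as a cycle (of length zero), as in the paper.
IsCycle : ∀ {n} → S n → Set
IsCycle ρ = ∀ x y → Moves ρ x → Moves ρ y → ∃ λ k → iter (ρ ⟨$⟩ʳ_) k x ≡ y

Disjoint : ∀ {n} → S n → S n → Set
Disjoint ρ χ = ∀ x → ρ ⟨$⟩ʳ x ≡ x ⊎ χ ⟨$⟩ʳ x ≡ x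

InOrbit : ∀ {n} → S n → Fin n → Fin n → Set
InOrbit g a y = ∃ λ k → iter (g ⟨$⟩ʳ_) k a ≡ y

-- ω is the cycle of the disjoint cycle decomposition of g containing a
-- (it acts as g on the orbit of a and fixes everything else; it is the
-- identity (0) if g fixes a)
CycleOf : ∀ {n} → S n → Fin n → S n → Set
CycleOf g a ω = ∀ x → (InOrbit g a x → ω ⟨$⟩ʳ x ≡ g ⟨$⟩ʳ x)
                    × (¬ InOrbit g a x → ω ⟨$⟩ʳ x ≡ x)
  where open import Data.Product.Base using (_×_)

last : ∀ {m} → Fin (suc m)
last {m} = fromℕ m

-- Contraction σ^CT ∈ S m of σ ∈ S (suc m):
--   σ^CT(x) = σ(n-1) if x = σ⁻¹(n-1),  σ^CT(x) = σ(x) otherwise.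
-- Implemented as: first swap σ⁻¹(n-1) and n-1, then apply σ; the
-- result fixes n-1 and we remove n-1 (stdlib `remove`).
CT : ∀ {m} → S (suc m) → S m
CT σ = remove last (transpose (σ ⟨$⟩ˡ last) last · σ)

CTformula : ∀ {m} → S (suc m) → Fin (suc m) → Fin (suc m)
CTformula σ x with x ≟ (σ ⟨$⟩ˡ last)
... | yes _ = σ ⟨$⟩ʳ last
... | no  _ = σ ⟨$⟩ʳ x

private
  punchIn-last : ∀ {m} (x : Fin m) → punchIn last x ≡ inject₁ x
  punchIn-last {suc m} zero    = refl
  punchIn-last {suc m} (suc x) = cong suc (punchIn-last x)

  punchOut-last : ∀ {m} {j : Fin (suc m)} (p : last ≢ j) → inject₁ (punchOut p) ≡ j
  punchOut-last {zero}  {zero}  p = ⊥-elim (p refl)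
  punchOut-last {suc m} {zero}  p = refl
  punchOut-last {suc m} {suc j} p = cong suc (punchOut-last {m} {j} _)

  punchOut-at : ∀ {m} {i j : Fin (suc m)} (p : i ≢ j) → i ≡ last → inject₁ (punchOut p) ≡ j
  punchOut-at p refl = punchOut-last p

  inject₁≢last : ∀ {m} (x : Fin m) → inject₁ x ≢ last
  inject₁≢last {suc m} zero    ()
  inject₁≢last {suc m} (suc x) e = inject₁≢last x (Data.Fin.Properties.suc-injective e)

CT-spec : ∀ {m} (σ : S (suc m)) (x : Fin m) →
          inject₁ (CT σ ⟨$⟩ʳ x) ≡ CTformula σ (inject₁ x)
CT-spec {m} σ x =
  trans (punchOut-at _ (trans (cong (σ ⟨$⟩ʳ_) (tlast (σ ⟨$⟩ˡ last))) (inverseʳ σ)))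
        (trans (cong (λ y → σ ⟨$⟩ʳ PC.transpose (σ ⟨$⟩ˡ last) last y) (punchIn-last x))
               (lem (inject₁ x ≟ (σ ⟨$⟩ˡ last))))
  where
  tlast : ∀ (a : Fin (suc m)) → PC.transpose a last last ≡ a
  tlast a with last ≟ a
  ... | yes e = e
  ... | no _ with last ≟ last {m}
  ...   | yes _ = refl
  ...   | no ne = ⊥-elim (ne refl)
  lem : ∀ d → σ ⟨$⟩ʳ PC.transpose (σ ⟨$⟩ˡ last) last (inject₁ x) ≡ CTformula σ (inject₁ x)
  lem _ with inject₁ x ≟ (σ ⟨$⟩ˡ last)
  ... | yes _ = refl
  ... | no _ with inject₁ x ≟ last {m}
  ...   | yes e = ⊥-elim (inject₁≢last x e)
  ...   | no _ = refl

-- S m viewed inside S (suc m) as the stabiliser of the last symbol n-1: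
-- the image of χ ∈ S m acts as χ on {0,…,n-2} and fixes n-1.
embed : ∀ {m} → S m → Fin (suc m) → Fin (suc m)
embed {m} χ y with y ≟ last {m}
... | yes _ = last
... | no ne = inject₁ (χ ⟨$⟩ʳ Data.Fin.Base.lower₁ y (λ e → ne (toℕ-last e)))
  where
  toℕ-last : ∀ {y : Fin (suc m)} → m ≡ Data.Fin.Base.toℕ y → y ≡ last
  toℕ-last {y} e = Data.Fin.Properties.toℕ-injective
    (trans (sym e) (sym (Data.Fin.Properties.toℕ-fromℕ m)))

-- With g = σ⁻¹τ and b = σ(n-1), the permutation (σ^CT)⁻¹τ^CT is (b n-1)·g with n-1 deleted from its
-- cycle.  As ρ fixes n-1 and b, it survives unchanged, and χ is what becomes of the cycles ω (through
-- n-1) and π (through b).  For b = n-1 the transposition is trivial; if b is off ω, it merges ω and π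
-- into one cycle; otherwise, writing ω = (n-1 d … b c … e), it splits ω into (d … b) and (n-1 c … e).
-- Deleting n-1 then loses n-1 and any point left fixed (b when d = b, c when c = e).  Since
-- hd(σ, τ) = ∣ σ⁻¹τ ∣, counting moved points case by case gives (1)–(4).

module Submission where

open import Defs
open import Data.Bool.Base using (true; false; if_then_else_)
open import Data.Nat.Base using (ℕ; zero; suc; pred; >-nonZero; _+_; _*_; _∸_; _≤_; _<_; z≤n)
import Data.Nat.Properties as ℕ
open import Data.Nat.DivMod using (_%_; _/_; m≡m%n+[m/n]*n; m%n<n)
open import Data.Fin.Base using (Fin; zero; suc; toℕ; fromℕ<; inject₁; punchIn; punchOut)
open import Data.Fin.Properties
  using (_≟_; any?; all?; pigeonhole; toℕ-fromℕ<; punchInᵢ≢i;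
         fromℕ≢inject₁; inject₁-injective; lower₁-inject₁′)
open import Data.Fin.Permutation using (inverseˡ; permutation)
open import Data.List.Base using (length; filter; tabulate)
open import Data.Product.Base using (∃; ∃₂; _×_; _,_; proj₁; proj₂)
open import Data.Sum.Base using (_⊎_; inj₁; inj₂; [_,_]′)
open import Data.Empty using (⊥; ⊥-elim)
open import Function.Base using (_∘_)
open import Relation.Nullary using (¬_; Dec; yes; no; does; ¬?; _⊎-dec_; _×-dec_)
open import Relation.Nullary.Decidable using (decidable-stable; toSum)
open import Relation.Unary using (Pred; Decidable)
open import Relation.Binary.PropositionalEquality
  using (_≡_; _≢_; refl; sym; trans; cong; cong₂; subst; module ≡-Reasoning)
open import Algebra.Properties.CommutativeMonoid.Sum ℕ.+-0-commutativeMonoid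
  using (sum; sum-cong-≗; ∑-distrib-+; sum-permute; sum-remove; sum-replicate-zero)

indicator : ∀ {P : Set} → Dec P → ℕ
indicator d = if does d then 1 else 0

differ : ∀ {n} → Fin n → Fin n → ℕ
differ a b = indicator (¬? (a ≟ b))

δ : ∀ {n} → Fin n → Fin n → ℕ
δ x a = indicator (x ≟ a)

moved : ∀ {n} → S n → Fin n → ℕ
moved χ x = differ (χ ⟨$⟩ʳ x) x

differ-≢ : ∀ {n} {a b : Fin n} → a ≢ b → differ a b ≡ 1
differ-≢ {a = a} {b} a≢b with a ≟ b
... | yes a≡b = ⊥-elim (a≢b a≡b)
... | no _    = refl

differ-≡ : ∀ {n} {a b : Fin n} → a ≡ b → differ a b ≡ 0
differ-≡ {a = a} {b} a≡b with a ≟ b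
... | yes _   = refl
... | no a≢b  = ⊥-elim (a≢b a≡b)

differ-sym : ∀ {n} (a b : Fin n) → differ a b ≡ differ b a
differ-sym a b with a ≟ b
... | yes a≡b = sym (differ-≡ (sym a≡b))
... | no a≢b  = sym (differ-≢ (a≢b ∘ sym))

δ-≡ : ∀ {n} {x a : Fin n} → x ≡ a → δ x a ≡ 1
δ-≡ {x = x} {a} x≡a with x ≟ a
... | yes _   = refl
... | no x≢a  = ⊥-elim (x≢a x≡a)

δ-≢ : ∀ {n} {x a : Fin n} → x ≢ a → δ x a ≡ 0
δ-≢ {x = x} {a} x≢a with x ≟ a
... | yes x≡a = ⊥-elim (x≢a x≡a)
... | no _    = refl

sum-zero : ∀ {n} {f : Fin n → ℕ} → (∀ x → f x ≡ 0) → sum f ≡ 0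
sum-zero {n} f≗0 = trans (sum-cong-≗ f≗0) (sum-replicate-zero n)

sum-δ : ∀ {n} (a : Fin n) → sum (λ x → δ x a) ≡ 1
sum-δ {suc n} a = begin
  sum (λ x → δ x a)                           ≡⟨ sum-remove {i = a} (λ x → δ x a) ⟩
  δ a a + sum (λ j → δ (punchIn a j) a)       ≡⟨ cong₂ _+_ (δ-≡ {x = a} refl) (sum-zero (λ j → δ-≢ (punchInᵢ≢i a j))) ⟩
  1                                           ∎
  where open ≡-Reasoning

sum-cong-+ : ∀ {n} (f g h k : Fin n → ℕ) → (∀ x → f x + g x ≡ h x + k x) → sum f + sum g ≡ sum h + sum k
sum-cong-+ f g h k pointwise =
  trans (sym (∑-distrib-+ f g)) (trans (sum-cong-≗ pointwise) (∑-distrib-+ h k))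

length-filter-tabulate : ∀ {A : Set} {P : Pred A _} (P? : Decidable P) {n} (h : Fin n → A) →
  length (filter P? (tabulate h)) ≡ sum (λ x → indicator (P? (h x)))
length-filter-tabulate P? {zero}  h = refl
length-filter-tabulate P? {suc n} h with does (P? (h zero))
... | true  = cong suc (length-filter-tabulate P? (h ∘ suc))
... | false = length-filter-tabulate P? (h ∘ suc)

∣∣-sum : ∀ {n} (χ : S n) → ∣ χ ∣ ≡ sum (moved χ)
∣∣-sum χ = length-filter-tabulate (λ x → ¬? ((χ ⟨$⟩ʳ x) ≟ x)) (λ x → x)

Least : (ℕ → Set) → ℕ → Set
Least Q j = Q j × (∀ i → i < j → ¬ Q i)

leastBelow : ∀ {Q : ℕ → Set} → (∀ i → Dec (Q i)) → ∀ N → (∃ (Least Q)) ⊎ (∀ i → i < N → ¬ Q i)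
leastBelow Q? zero = inj₂ (λ _ ())
leastBelow Q? (suc N) with leastBelow Q? N
... | inj₁ found = inj₁ found
... | inj₂ none with Q? N
...   | yes qN = inj₁ (N , qN , none)
...   | no ¬qN = inj₂ λ i i<1+N → [ none i , (λ { refl → ¬qN }) ]′ (ℕ.m≤n⇒m<n∨m≡n (ℕ.≤-pred i<1+N))

leastWitness : ∀ {Q : ℕ → Set} → (∀ i → Dec (Q i)) → ∀ k → Q k → ∃ (Least Q)
leastWitness Q? k qk with leastBelow Q? (suc k)
... | inj₁ found = found
... | inj₂ none  = ⊥-elim (none k (ℕ.n<1+n k) qk)

iter-+ : ∀ {A : Set} (f : A → A) i j x → iter f (i + j) x ≡ iter f i (iter f j x)
iter-+ f zero    j x = refl
iter-+ f (suc i) j x = cong f (iter-+ f i j x)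

module Orbit {n : ℕ} (f : S n) where

  F : Fin n → Fin n
  F x = f ⟨$⟩ʳ x

  infix 4 _⇝_
  _⇝_ : Fin n → Fin n → Set
  a ⇝ x = InOrbit f a x

  F-injective : ∀ {x y} → F x ≡ F y → x ≡ y
  F-injective {x} {y} e = trans (sym (inverseˡ f)) (trans (cong (f ⟨$⟩ˡ_) e) (inverseˡ f))

  iter-injective : ∀ k {x y} → iter F k x ≡ iter F k y → x ≡ y
  iter-injective zero    e = e
  iter-injective (suc k) e = iter-injective k (F-injective e)

  iter-fixed : ∀ {a} → F a ≡ a → ∀ k → iter F k a ≡ a
  iter-fixed e zero    = refl
  iter-fixed e (suc k) = trans (cong F (iter-fixed e k)) e

  iter-periodic : ∀ {a} p → iter F p a ≡ a → ∀ q → iter F (q * p) a ≡ a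
  iter-periodic p e zero = refl
  iter-periodic {a} p e (suc q) =
    trans (iter-+ F p (q * p) a) (trans (cong (iter F p) (iter-periodic p e q)) e)

  -- Pigeonhole on a, F a, …, Fⁿ a; injectivity of F turns the collision into a return to a.
  period : ∀ a → ∃ λ p → iter F (suc p) a ≡ a
  period a with pigeonhole (ℕ.n<1+n n) (λ (i : Fin (suc n)) → iter F (toℕ i) a)
  ... | i , j , i<j , Fⁱa≡Fʲa = pred (toℕ j ∸ toℕ i) , returns
    where
    d : ℕ
    d = toℕ j ∸ toℕ i
    open ≡-Reasoning
    d≡1+pred : d ≡ suc (pred d)
    d≡1+pred = sym (ℕ.suc-pred d {{>-nonZero (ℕ.m<n⇒0<n∸m i<j)}})
    shifted : iter F (toℕ i) (iter F d a) ≡ iter F (toℕ i) a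
    shifted = begin
      iter F (toℕ i) (iter F d a) ≡⟨ iter-+ F (toℕ i) d a ⟨
      iter F (toℕ i + d) a        ≡⟨ cong (λ t → iter F t a) (ℕ.m+[n∸m]≡n (ℕ.<⇒≤ i<j)) ⟩
      iter F (toℕ j) a            ≡⟨ Fⁱa≡Fʲa ⟨
      iter F (toℕ i) a            ∎
    returns : iter F (suc (pred d)) a ≡ a
    returns = trans (cong (λ t → iter F t a) (sym d≡1+pred)) (iter-injective (toℕ i) shifted)

  orbit-refl : ∀ a → a ⇝ a
  orbit-refl a = 0 , refl

  orbit-step : ∀ {a x} → a ⇝ x → a ⇝ F x
  orbit-step (k , e) = suc k , cong F e

  orbit-F : ∀ a → a ⇝ F a
  orbit-F a = orbit-step (orbit-refl a)

  orbit-trans : ∀ {a x y} → a ⇝ x → x ⇝ y → a ⇝ y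
  orbit-trans {a} (k , refl) (j , refl) = j + k , iter-+ F j k a

  orbit-sym : ∀ {a x} → a ⇝ x → x ⇝ a
  orbit-sym {a} (k , refl) with period a
  ... | p , Fᵖ⁺¹a≡a = k * p , (begin
      iter F (k * p) (iter F k a) ≡⟨ iter-+ F (k * p) k a ⟨
      iter F (k * p + k) a        ≡⟨ cong (λ t → iter F t a) (trans (ℕ.+-comm (k * p) k) (sym (ℕ.*-suc k p))) ⟩
      iter F (k * suc p) a        ≡⟨ iter-periodic (suc p) Fᵖ⁺¹a≡a k ⟩
      a                           ∎)
    where open ≡-Reasoning

  orbit-of-fixed : ∀ {a x} → F a ≡ a → a ⇝ x → x ≡ a
  orbit-of-fixed e (k , refl) = iter-fixed e k

  fixed-on-orbit : ∀ {a x} → a ⇝ x → F x ≡ x → F a ≡ a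
  fixed-on-orbit {a} {x} r Fx≡x =
    subst (λ t → F t ≡ t) (sym (orbit-of-fixed Fx≡x (orbit-sym r))) Fx≡x

  -- Only the specification of orbit? matters; keeping it abstract stops goals from unfolding it.
  abstract
    orbit? : ∀ a x → Dec (a ⇝ x)
    orbit? a x with period a
    ... | p , Fᵖ⁺¹a≡a with any? (λ (i : Fin (suc p)) → iter F (toℕ i) a ≟ x)
    ...   | yes (i , e) = yes (toℕ i , e)
    ...   | no none = no λ { (k , e) → none (fromℕ< (k%< k) , trans (reduced k) e) }
      where
      open ≡-Reasoning
      k%< : ∀ k → k % suc p < suc p
      k%< k = m%n<n k (suc p)
      reduce : ∀ k → iter F (k % suc p) a ≡ iter F k a
      reduce k = sym (begin
        iter F k a                                         ≡⟨ cong (λ t → iter F t a) (m≡m%n+[m/n]*n k (suc p)) ⟩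
        iter F (k % suc p + (k / suc p) * suc p) a         ≡⟨ iter-+ F (k % suc p) _ a ⟩
        iter F (k % suc p) (iter F ((k / suc p) * suc p) a) ≡⟨ cong (iter F (k % suc p)) (iter-periodic (suc p) Fᵖ⁺¹a≡a (k / suc p)) ⟩
        iter F (k % suc p) a                               ∎)
      reduced : ∀ k → iter F (toℕ (fromℕ< (k%< k))) a ≡ iter F k a
      reduced k = trans (cong (λ t → iter F t a) (toℕ-fromℕ< (k%< k))) (reduce k)

  orbit-induction : ∀ (P : Fin n → Set) {a} → P a → (∀ y → P y → P (F y)) → ∀ {x} → a ⇝ x → P x
  orbit-induction P pa step (zero  , refl) = pa
  orbit-induction P pa step (suc k , refl) = step _ (orbit-induction P pa step (k , refl))

  iter-agree : ∀ (G : Fin n → Fin n) s j → (∀ i → i < j → G (iter F i s) ≡ F (iter F i s)) →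
               ∀ i → i ≤ j → iter G i s ≡ iter F i s
  iter-agree G s j h zero    _     = refl
  iter-agree G s j h (suc i) 1+i≤j = trans (cong G (iter-agree G s j h i (ℕ.<⇒≤ 1+i≤j))) (h i 1+i≤j)

∣∣-cong : ∀ {n} (α β : S n) → α ≈ β → ∣ α ∣ ≡ ∣ β ∣
∣∣-cong α β α≈β = trans (∣∣-sum α) (trans (sum-cong-≗ (λ x → cong (λ t → differ t x) (α≈β x))) (sym (∣∣-sum β)))

∣∣-disjoint-product : ∀ {n} (α β : S n) → Disjoint α β → ∣ α · β ∣ ≡ ∣ α ∣ + ∣ β ∣
∣∣-disjoint-product α β α#β = begin
  ∣ α · β ∣                          ≡⟨ ∣∣-sum (α · β) ⟩
  sum (moved (α · β))                ≡⟨ sum-cong-≗ pointwise ⟩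
  sum (λ x → moved α x + moved β x)  ≡⟨ ∑-distrib-+ (moved α) (moved β) ⟩
  sum (moved α) + sum (moved β)      ≡⟨ cong₂ _+_ (∣∣-sum α) (∣∣-sum β) ⟨
  ∣ α ∣ + ∣ β ∣                      ∎
  where
  open ≡-Reasoning
  pointwise : ∀ x → moved (α · β) x ≡ moved α x + moved β x
  pointwise x with α#β x
  ... | inj₁ αx≡x = trans (cong (λ t → differ (β ⟨$⟩ʳ t) x) αx≡x) (cong (_+ moved β x) (sym (differ-≡ αx≡x)))
  ... | inj₂ βx≡x = trans (cong (λ t → differ t x) β-fixes-αx)
                          (trans (sym (ℕ.+-identityʳ (moved α x))) (cong (moved α x +_) (sym (differ-≡ βx≡x))))
    where
    β-fixes-αx : β ⟨$⟩ʳ (α ⟨$⟩ʳ x) ≡ α ⟨$⟩ʳ x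
    β-fixes-αx with α#β (α ⟨$⟩ʳ x)
    ... | inj₂ β-fixes = β-fixes
    ... | inj₁ α-fixes = trans (cong (β ⟨$⟩ʳ_) αx≡x) (trans βx≡x (sym αx≡x))
      where
      αx≡x : α ⟨$⟩ʳ x ≡ x
      αx≡x = Orbit.F-injective α α-fixes

∣∣-id : ∀ {n} (α : S n) → α ≈ id → ∣ α ∣ ≡ 0
∣∣-id α α≈id = trans (∣∣-sum α) (sum-zero (λ x → differ-≡ (α≈id x)))

isCycle-id : ∀ {n} (α : S n) → α ≈ id → IsCycle α
isCycle-id α α≈id x y mx = ⊥-elim (mx (α≈id x))

ProductOfTwoCycles : ∀ {m} → S m → (ℕ → Set) → Set
ProductOfTwoCycles {m} χ Size = ∃₂ λ (ω′ π′ : S m) →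
  IsCycle ω′ × IsCycle π′ × Disjoint ω′ π′ × χ ≈ ω′ · π′ × Size (∣ ω′ ∣ + ∣ π′ ∣)

productOfTwoCycles-map : ∀ {m} {χ : S m} {P Q : ℕ → Set} → (∀ s → P s → Q s) →
                         ProductOfTwoCycles χ P → ProductOfTwoCycles χ Q
productOfTwoCycles-map P⇒Q (ω′ , π′ , ω′-cycle , π′-cycle , ω′#π′ , χ≈ω′π′ , p) =
  ω′ , π′ , ω′-cycle , π′-cycle , ω′#π′ , χ≈ω′π′ , P⇒Q _ p

module Cycles {m : ℕ} (χ : S m) where
  open Orbit χ

  isCycle-hub : ∀ u → (∀ z → Moves χ z → u ⇝ z) → IsCycle χ
  isCycle-hub u hub x y mx my = orbit-trans (orbit-sym (hub x mx)) (hub y my)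

  module _ (u : Fin m) where

    private
      along : Fin m → Fin m
      along x with orbit? u x
      ... | yes _ = F x
      ... | no  _ = x

      back : Fin m → Fin m
      back x with orbit? u x
      ... | yes _ = χ ⟨$⟩ˡ x
      ... | no  _ = x

      orbit-back : ∀ {x} → u ⇝ x → u ⇝ χ ⟨$⟩ˡ x
      orbit-back r = orbit-trans r (orbit-sym (1 , inverseʳ χ))

    along-on : ∀ {x} → u ⇝ x → along x ≡ F x
    along-on {x} r with orbit? u x
    ... | yes _ = refl
    ... | no ¬r = ⊥-elim (¬r r)

    along-off : ∀ {x} → ¬ u ⇝ x → along x ≡ x
    along-off {x} ¬r with orbit? u x
    ... | yes r = ⊥-elim (¬r r)
    ... | no _  = refl

    private
      back-on : ∀ {x} → u ⇝ x → back x ≡ χ ⟨$⟩ˡ x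
      back-on {x} r with orbit? u x
      ... | yes _ = refl
      ... | no ¬r = ⊥-elim (¬r r)

      back-off : ∀ {x} → ¬ u ⇝ x → back x ≡ x
      back-off {x} ¬r with orbit? u x
      ... | yes r = ⊥-elim (¬r r)
      ... | no _  = refl

      along-back : ∀ x → along (back x) ≡ x
      along-back x with orbit? u x
      ... | yes r = trans (along-on (orbit-back r)) (inverseʳ χ)
      ... | no ¬r = along-off ¬r

      back-along : ∀ x → back (along x) ≡ x
      back-along x with orbit? u x
      ... | yes r = trans (back-on (orbit-step r)) (inverseˡ χ)
      ... | no ¬r = back-off ¬r

    cycleThrough : S m
    cycleThrough = permutation along back along-back back-along

    iter-cycleThrough : ∀ {x} → u ⇝ x → ∀ k → iter along k x ≡ iter F k x
    iter-cycleThrough r zero    = refl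
    iter-cycleThrough r (suc k) = trans (cong along (iter-cycleThrough r k)) (along-on (orbit-trans r (k , refl)))

    moves-cycleThrough : ∀ {z} → Moves cycleThrough z → u ⇝ z
    moves-cycleThrough {z} mz = decidable-stable (orbit? u z) (mz ∘ along-off)

    isCycle-cycleThrough : IsCycle cycleThrough
    isCycle-cycleThrough x y mx my with orbit-trans (orbit-sym (moves-cycleThrough mx)) (moves-cycleThrough my)
    ... | k , Fᵏx≡y = k , trans (iter-cycleThrough (moves-cycleThrough mx) k) Fᵏx≡y

  product-of-two-cycles : ∀ u v → ¬ v ⇝ u → (∀ z → Moves χ z → u ⇝ z ⊎ v ⇝ z) →
                          ProductOfTwoCycles χ (_≡ ∣ χ ∣)
  product-of-two-cycles u v ¬v⇝u cover =
    cu , cv , isCycle-cycleThrough u , isCycle-cycleThrough v , disjoint , decomposition , size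
    where
    cu cv : S m
    cu = cycleThrough u
    cv = cycleThrough v
    exclusive : ∀ {z} → u ⇝ z → ¬ v ⇝ z
    exclusive ru rv = ¬v⇝u (orbit-trans rv (orbit-sym ru))
    disjoint : Disjoint cu cv
    disjoint z = [ (λ ru → inj₂ (along-off v (exclusive ru))) , (λ ¬ru → inj₁ (along-off u ¬ru)) ]′ (toSum (orbit? u z))
    fixed-elsewhere : ∀ {z} → ¬ u ⇝ z → ¬ v ⇝ z → χ ⟨$⟩ʳ z ≡ z
    fixed-elsewhere {z} ¬ru ¬rv = decidable-stable (χ ⟨$⟩ʳ z ≟ z) λ mz → [ ¬ru , ¬rv ]′ (cover z mz)
    decomposition : χ ≈ cu · cv
    decomposition z = [ on-u , off-u ]′ (toSum (orbit? u z))
      where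
      on-u : u ⇝ z → χ ⟨$⟩ʳ z ≡ cv ⟨$⟩ʳ (cu ⟨$⟩ʳ z)
      on-u ru = sym (trans (cong (cv ⟨$⟩ʳ_) (along-on u ru)) (along-off v (exclusive (orbit-step ru))))
      off-u : ¬ u ⇝ z → χ ⟨$⟩ʳ z ≡ cv ⟨$⟩ʳ (cu ⟨$⟩ʳ z)
      off-u ¬ru = trans (χz≡cvz (toSum (orbit? v z))) (cong (cv ⟨$⟩ʳ_) (sym (along-off u ¬ru)))
        where
        χz≡cvz : v ⇝ z ⊎ ¬ v ⇝ z → χ ⟨$⟩ʳ z ≡ cv ⟨$⟩ʳ z
        χz≡cvz (inj₁ rv)  = sym (along-on v rv)
        χz≡cvz (inj₂ ¬rv) = trans (fixed-elsewhere ¬ru ¬rv) (sym (along-off v ¬rv))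
    moved-split : ∀ z → moved χ z ≡ moved cu z + moved cv z
    moved-split z = [ on-u , off-u ]′ (toSum (orbit? u z))
      where
      on-u : u ⇝ z → moved χ z ≡ moved cu z + moved cv z
      on-u ru = sym (trans (cong₂ _+_ (cong (λ t → differ t z) (along-on u ru)) (differ-≡ (along-off v (exclusive ru))))
                           (ℕ.+-identityʳ _))
      off-u : ¬ u ⇝ z → moved χ z ≡ moved cu z + moved cv z
      off-u ¬ru = trans (by-v (toSum (orbit? v z))) (cong (_+ moved cv z) (sym (differ-≡ (along-off u ¬ru))))
        where
        by-v : v ⇝ z ⊎ ¬ v ⇝ z → moved χ z ≡ moved cv z
        by-v (inj₁ rv)  = cong (λ t → differ t z) (sym (along-on v rv))
        by-v (inj₂ ¬rv) = trans (differ-≡ (fixed-elsewhere ¬ru ¬rv)) (sym (differ-≡ (along-off v ¬rv)))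
    size : ∣ cu ∣ + ∣ cv ∣ ≡ ∣ χ ∣
    size = begin
      ∣ cu ∣ + ∣ cv ∣                 ≡⟨ cong₂ _+_ (∣∣-sum cu) (∣∣-sum cv) ⟩
      sum (moved cu) + sum (moved cv) ≡⟨ ∑-distrib-+ (moved cu) (moved cv) ⟨
      sum (λ z → moved cu z + moved cv z) ≡⟨ sum-cong-≗ moved-split ⟨
      sum (moved χ)                   ≡⟨ ∣∣-sum χ ⟨
      ∣ χ ∣                           ∎
      where open ≡-Reasoning

inject₁≢last : ∀ {m} (z : Fin m) → inject₁ z ≢ last
inject₁≢last z = fromℕ≢inject₁ ∘ sym

inject₁-onto : ∀ {m} (x : Fin (suc m)) → x ≢ last → ∃ λ z → inject₁ z ≡ x
inject₁-onto {zero}  zero    x≢last = ⊥-elim (x≢last refl)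
inject₁-onto {suc m} zero    _      = zero , refl
inject₁-onto {suc m} (suc x) x≢last with inject₁-onto x (x≢last ∘ cong suc)
... | z , refl = suc z , refl

punchIn-last : ∀ {m} (x : Fin m) → punchIn last x ≡ inject₁ x
punchIn-last {suc m} zero    = refl
punchIn-last {suc m} (suc x) = cong suc (punchIn-last x)

inject₁-punchOut-last : ∀ {m} {j : Fin (suc m)} (last≢j : last ≢ j) → inject₁ (punchOut last≢j) ≡ j
inject₁-punchOut-last {zero}  {zero}  last≢j = ⊥-elim (last≢j refl)
inject₁-punchOut-last {suc m} {zero}  _      = refl
inject₁-punchOut-last {suc m} {suc j} _      = cong suc (inject₁-punchOut-last {m} {j} _)

embed-last : ∀ {m} (χ : S m) → embed χ last ≡ last
embed-last {m} χ with last {m} ≟ last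
... | yes _          = refl
... | no last≢last   = ⊥-elim (last≢last refl)

embed-inject₁ : ∀ {m} (χ : S m) (z : Fin m) → embed χ (inject₁ z) ≡ inject₁ (χ ⟨$⟩ʳ z)
embed-inject₁ {m} χ z with inject₁ z ≟ last {m}
... | yes z≡last = ⊥-elim (inject₁≢last z z≡last)
... | no _       = cong (λ t → inject₁ (χ ⟨$⟩ʳ t)) (lower₁-inject₁′ z _)

iter-embed : ∀ {m} (χ : S m) k z → iter (embed χ) k (inject₁ z) ≡ inject₁ (iter (χ ⟨$⟩ʳ_) k z)
iter-embed χ zero    z = refl
iter-embed χ (suc k) z = trans (cong (embed χ) (iter-embed χ k z)) (embed-inject₁ χ _)

inject₁-remove-last⁻¹ : ∀ {m} (ρ : S (suc m)) → ρ ⟨$⟩ʳ last ≡ last → ∀ z →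
  inject₁ (remove last ρ ⟨$⟩ˡ z) ≡ ρ ⟨$⟩ˡ inject₁ z
inject₁-remove-last⁻¹ ρ ρL≡L z =
  trans (inject₁-punchOut-last _) (cong (ρ ⟨$⟩ˡ_) (trans (cong (λ t → punchIn t z) ρL≡L) (punchIn-last z)))

movedEmbed : ∀ {m} → S m → Fin (suc m) → ℕ
movedEmbed χ x = differ (embed χ x) x

sum-last : ∀ {m} (f : Fin (suc m) → ℕ) → sum f ≡ f last + sum (f ∘ inject₁)
sum-last f = trans (sum-remove {i = last} f) (cong (f last +_) (sum-cong-≗ (cong f ∘ punchIn-last)))

differ-inject₁ : ∀ {m} (a b : Fin m) → differ (inject₁ a) (inject₁ b) ≡ differ a b
differ-inject₁ a b with a ≟ b
... | yes a≡b = differ-≡ (cong inject₁ a≡b)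
... | no a≢b  = differ-≢ (a≢b ∘ inject₁-injective)

∣∣-embed : ∀ {m} (χ : S m) → ∣ χ ∣ ≡ sum (movedEmbed χ)
∣∣-embed χ = sym (begin
  sum (movedEmbed χ)                                 ≡⟨ sum-last (movedEmbed χ) ⟩
  movedEmbed χ last + sum (movedEmbed χ ∘ inject₁)   ≡⟨ cong (_+ sum (movedEmbed χ ∘ inject₁)) (differ-≡ (embed-last χ)) ⟩
  sum (movedEmbed χ ∘ inject₁)                       ≡⟨ sum-cong-≗ moved-inject₁ ⟩
  sum (moved χ)                                      ≡⟨ ∣∣-sum χ ⟨
  ∣ χ ∣                                              ∎)
  where
  open ≡-Reasoning
  moved-inject₁ : ∀ z → movedEmbed χ (inject₁ z) ≡ moved χ z
  moved-inject₁ z = trans (cong (λ t → differ t (inject₁ z)) (embed-inject₁ χ z)) (differ-inject₁ (χ ⟨$⟩ʳ z) z)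

hd-sum : ∀ {n} (σ τ : S n) → hd σ τ ≡ sum (moved (σ ⁻¹ · τ))
hd-sum σ τ = begin
  hd σ τ                                               ≡⟨ length-filter-tabulate (λ x → ¬? ((σ ⟨$⟩ʳ x) ≟ (τ ⟨$⟩ʳ x))) (λ x → x) ⟩
  sum (λ x → differ (σ ⟨$⟩ʳ x) (τ ⟨$⟩ʳ x))             ≡⟨ sum-permute _ (σ ⁻¹) ⟩
  sum (λ y → differ (σ ⟨$⟩ʳ (σ ⟨$⟩ˡ y)) (τ ⟨$⟩ʳ (σ ⟨$⟩ˡ y))) ≡⟨ sum-cong-≗ moved-σ⁻¹ ⟩
  sum (moved (σ ⁻¹ · τ))                               ∎
  where
  open ≡-Reasoning
  moved-σ⁻¹ : ∀ y → differ (σ ⟨$⟩ʳ (σ ⟨$⟩ˡ y)) (τ ⟨$⟩ʳ (σ ⟨$⟩ˡ y)) ≡ moved (σ ⁻¹ · τ) y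
  moved-σ⁻¹ y = trans (cong (λ t → differ t (τ ⟨$⟩ʳ (σ ⟨$⟩ˡ y))) (inverseʳ σ)) (differ-sym y (τ ⟨$⟩ʳ (σ ⟨$⟩ˡ y)))

hd≡∣σ⁻¹τ∣ : ∀ {n} (σ τ : S n) → hd σ τ ≡ ∣ σ ⁻¹ · τ ∣
hd≡∣σ⁻¹τ∣ σ τ = trans (hd-sum σ τ) (sym (∣∣-sum (σ ⁻¹ · τ)))

CTformula-at : ∀ {m} (σ : S (suc m)) {x} → x ≡ σ ⟨$⟩ˡ last → CTformula σ x ≡ σ ⟨$⟩ʳ last
CTformula-at σ {x} x≡a with x ≟ σ ⟨$⟩ˡ last
... | yes _  = refl
... | no x≢a = ⊥-elim (x≢a x≡a)

CTformula-off : ∀ {m} (σ : S (suc m)) {x} → x ≢ σ ⟨$⟩ˡ last → CTformula σ x ≡ σ ⟨$⟩ʳ x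
CTformula-off σ {x} x≢a with x ≟ σ ⟨$⟩ˡ last
... | yes x≡a = ⊥-elim (x≢a x≡a)
... | no _    = refl

-- For g = σ⁻¹τ and b = σ(n-1) this is (σ^CT)⁻¹τ^CT (contract-quotient):
-- the permutation (b n-1)·g with n-1 then deleted from its cycle.
contractAt : ∀ {m} → S (suc m) → Fin (suc m) → Fin (suc m) → Fin (suc m)
contractAt g b x with x ≟ b | g ⟨$⟩ʳ last ≟ last | g ⟨$⟩ʳ x ≟ last
... | yes _ | yes _ | _     = g ⟨$⟩ʳ b
... | yes _ | no _  | _     = g ⟨$⟩ʳ last
... | no _  | _     | yes _ = g ⟨$⟩ʳ b
... | no _  | _     | no _  = g ⟨$⟩ʳ x

module ContractAt {m} (g : S (suc m)) (b : Fin (suc m)) where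

  contractAt-b-fixed : g ⟨$⟩ʳ last ≡ last → contractAt g b b ≡ g ⟨$⟩ʳ b
  contractAt-b-fixed gL≡L with b ≟ b | g ⟨$⟩ʳ last ≟ last
  ... | yes _   | yes _    = refl
  ... | yes _   | no gL≢L  = ⊥-elim (gL≢L gL≡L)
  ... | no b≢b  | _        = ⊥-elim (b≢b refl)

  contractAt-b-moved : g ⟨$⟩ʳ last ≢ last → contractAt g b b ≡ g ⟨$⟩ʳ last
  contractAt-b-moved gL≢L with b ≟ b | g ⟨$⟩ʳ last ≟ last
  ... | yes _   | yes gL≡L = ⊥-elim (gL≢L gL≡L)
  ... | yes _   | no _     = refl
  ... | no b≢b  | _        = ⊥-elim (b≢b refl)

  contractAt-into-last : ∀ {x} → x ≢ b → g ⟨$⟩ʳ x ≡ last → contractAt g b x ≡ g ⟨$⟩ʳ b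
  contractAt-into-last {x} x≢b gx≡L with x ≟ b | g ⟨$⟩ʳ last ≟ last | g ⟨$⟩ʳ x ≟ last
  ... | yes x≡b | _ | _        = ⊥-elim (x≢b x≡b)
  ... | no _    | _ | yes _    = refl
  ... | no _    | _ | no gx≢L  = ⊥-elim (gx≢L gx≡L)

  contractAt-other : ∀ {x} → x ≢ b → g ⟨$⟩ʳ x ≢ last → contractAt g b x ≡ g ⟨$⟩ʳ x
  contractAt-other {x} x≢b gx≢L with x ≟ b | g ⟨$⟩ʳ last ≟ last | g ⟨$⟩ʳ x ≟ last
  ... | yes x≡b | _ | _        = ⊥-elim (x≢b x≡b)
  ... | no _    | _ | yes gx≡L = ⊥-elim (gx≢L gx≡L)
  ... | no _    | _ | no _     = refl

module _ {m} (σ τ : S (suc m)) where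
  private
    g : S (suc m)
    g = σ ⁻¹ · τ
    b a : Fin (suc m)
    b = σ ⟨$⟩ʳ last
    a = σ ⟨$⟩ˡ last
  open ContractAt g b

  contract-quotient : ∀ y → inject₁ ((CT σ ⁻¹ · CT τ) ⟨$⟩ʳ y) ≡ contractAt g b (inject₁ y)
  contract-quotient y = trans (CT-spec τ w) (sym ([ at-a , off-a ]′ (toSum (inject₁ w ≟ a))))
    where
    w : Fin m
    w = CT σ ⟨$⟩ˡ y
    y≡CTσw : inject₁ y ≡ CTformula σ (inject₁ w)
    y≡CTσw = trans (cong inject₁ (sym (inverseʳ (CT σ)))) (CT-spec σ w)
    τ-last : ∀ {x} → x ≡ τ ⟨$⟩ˡ last → τ ⟨$⟩ʳ x ≡ last
    τ-last refl = inverseʳ τ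
    τ-not-last : ∀ {x} → x ≢ τ ⟨$⟩ˡ last → τ ⟨$⟩ʳ x ≢ last
    τ-not-last x≢ τx≡L = x≢ (trans (sym (inverseˡ τ)) (cong (τ ⟨$⟩ˡ_) τx≡L))
    gb≡τL : g ⟨$⟩ʳ b ≡ τ ⟨$⟩ʳ last
    gb≡τL = cong (τ ⟨$⟩ʳ_) (inverseˡ σ)
    at-a : inject₁ w ≡ a → contractAt g b (inject₁ y) ≡ CTformula τ (inject₁ w)
    at-a w≡a = trans (cong (contractAt g b) (trans y≡CTσw (CTformula-at σ w≡a)))
                     ([ at-τa , off-τa ]′ (toSum (inject₁ w ≟ τ ⟨$⟩ˡ last)))
      where
      at-τa : inject₁ w ≡ τ ⟨$⟩ˡ last → contractAt g b b ≡ CTformula τ (inject₁ w)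
      at-τa w≡τa = trans (contractAt-b-fixed (τ-last (trans (sym w≡a) w≡τa)))
                         (trans gb≡τL (sym (CTformula-at τ w≡τa)))
      off-τa : inject₁ w ≢ τ ⟨$⟩ˡ last → contractAt g b b ≡ CTformula τ (inject₁ w)
      off-τa w≢τa = trans (contractAt-b-moved (τ-not-last (λ a≡τa → w≢τa (trans w≡a a≡τa))))
                          (trans (cong (τ ⟨$⟩ʳ_) (sym w≡a)) (sym (CTformula-off τ w≢τa)))
    off-a : inject₁ w ≢ a → contractAt g b (inject₁ y) ≡ CTformula τ (inject₁ w)
    off-a w≢a = [ at-τa , off-τa ]′ (toSum (inject₁ w ≟ τ ⟨$⟩ˡ last))
      where
      y≡σw : inject₁ y ≡ σ ⟨$⟩ʳ inject₁ w
      y≡σw = trans y≡CTσw (CTformula-off σ w≢a)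
      gy≡τw : g ⟨$⟩ʳ inject₁ y ≡ τ ⟨$⟩ʳ inject₁ w
      gy≡τw = cong (τ ⟨$⟩ʳ_) (trans (cong (σ ⟨$⟩ˡ_) y≡σw) (inverseˡ σ))
      y≢b : inject₁ y ≢ b
      y≢b y≡b = inject₁≢last w (Orbit.F-injective σ (trans (sym y≡σw) y≡b))
      at-τa : inject₁ w ≡ τ ⟨$⟩ˡ last → contractAt g b (inject₁ y) ≡ CTformula τ (inject₁ w)
      at-τa w≡τa = trans (contractAt-into-last y≢b (trans gy≡τw (τ-last w≡τa)))
                         (trans gb≡τL (sym (CTformula-at τ w≡τa)))
      off-τa : inject₁ w ≢ τ ⟨$⟩ˡ last → contractAt g b (inject₁ y) ≡ CTformula τ (inject₁ w)
      off-τa w≢τa = trans (contractAt-other y≢b (λ gy≡L → τ-not-last w≢τa (trans (sym gy≡τw) gy≡L)))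
                          (trans gy≡τw (sym (CTformula-off τ w≢τa)))

module Setting {m : ℕ} (g : S (suc m)) (b : Fin (suc m)) (ω π ρ : S (suc m))
  (ω-cycle : CycleOf g last ω) (π-cycle : CycleOf g b π)
  (g≈ρωπ : ¬ (ω ≈ π) → g ≈ ρ · ω · π) (g≈ρω : ω ≈ π → g ≈ ρ · ω)
  (ρ#ω : Disjoint ρ ω) (ρ#π : Disjoint ρ π) where

  open Orbit g
  open ContractAt g b

  -- The cycles of g through L and b read (L d … e) and (b c …).
  L d c e : Fin (suc m)
  L = last
  d = F L
  c = F b
  e = g ⟨$⟩ˡ L

  H : Fin (suc m) → Fin (suc m)
  H = contractAt g b

  F-e : F e ≡ L
  F-e = inverseʳ g

  into-L⇒e : ∀ {x} → F x ≡ L → x ≡ e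
  into-L⇒e Fx≡L = F-injective (trans Fx≡L (sym F-e))

  L⇝e : L ⇝ e
  L⇝e = orbit-sym (subst (e ⇝_) F-e (orbit-F e))

  ω-on : ∀ {x} → L ⇝ x → ω ⟨$⟩ʳ x ≡ F x
  ω-on {x} = proj₁ (ω-cycle x)
  ω-off : ∀ {x} → ¬ L ⇝ x → ω ⟨$⟩ʳ x ≡ x
  ω-off {x} = proj₂ (ω-cycle x)
  π-on : ∀ {x} → b ⇝ x → π ⟨$⟩ʳ x ≡ F x
  π-on {x} = proj₁ (π-cycle x)
  π-off : ∀ {x} → ¬ b ⇝ x → π ⟨$⟩ʳ x ≡ x
  π-off {x} = proj₂ (π-cycle x)

  ω-moves : ∀ {x} → L ⇝ x → F L ≢ L → ω ⟨$⟩ʳ x ≢ x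
  ω-moves r FL≢L ωx≡x = FL≢L (fixed-on-orbit r (trans (sym (ω-on r)) ωx≡x))
  π-moves : ∀ {x} → b ⇝ x → F b ≢ b → π ⟨$⟩ʳ x ≢ x
  π-moves r Fb≢b πx≡x = Fb≢b (fixed-on-orbit r (trans (sym (π-on r)) πx≡x))

  ω≈id : F L ≡ L → ω ≈ id
  ω≈id FL≡L x = [ (λ r → trans (ω-on r) (subst (λ t → F t ≡ t) (sym (orbit-of-fixed FL≡L r)) FL≡L)) , ω-off ]′
                   (toSum (orbit? L x))
  π≈id : F b ≡ b → π ≈ id
  π≈id Fb≡b x = [ (λ r → trans (π-on r) (subst (λ t → F t ≡ t) (sym (orbit-of-fixed Fb≡b r)) Fb≡b)) , π-off ]′
                   (toSum (orbit? b x))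

  orbits-meet : ∀ {x} → L ⇝ x → b ⇝ x → ω ≈ π
  orbits-meet L⇝x b⇝x y = [ on , off ]′ (toSum (orbit? L y))
    where
    on : L ⇝ y → ω ⟨$⟩ʳ y ≡ π ⟨$⟩ʳ y
    on r = trans (ω-on r) (sym (π-on (orbit-trans (orbit-trans b⇝x (orbit-sym L⇝x)) r)))
    off : ¬ L ⇝ y → ω ⟨$⟩ʳ y ≡ π ⟨$⟩ʳ y
    off ¬r = trans (ω-off ¬r) (sym (π-off (λ r → ¬r (orbit-trans (orbit-trans L⇝x (orbit-sym b⇝x)) r))))

  ω#π : ¬ (ω ≈ π) → Disjoint ω π
  ω#π ω≉π x = [ (λ r → inj₂ (π-off (λ r′ → ω≉π (orbits-meet r r′)))) , (inj₁ ∘ ω-off) ]′ (toSum (orbit? L x))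

  ω≈π? : Dec (ω ≈ π)
  ω≈π? = all? (λ y → ω ⟨$⟩ʳ y ≟ π ⟨$⟩ʳ y)

  ρ-moved⇒ω-fixed : ∀ {x} → ρ ⟨$⟩ʳ x ≢ x → ω ⟨$⟩ʳ x ≡ x
  ρ-moved⇒ω-fixed {x} ρx≢x = [ ⊥-elim ∘ ρx≢x , (λ ωx≡x → ωx≡x) ]′ (ρ#ω x)
  ρ-moved⇒π-fixed : ∀ {x} → ρ ⟨$⟩ʳ x ≢ x → π ⟨$⟩ʳ x ≡ x
  ρ-moved⇒π-fixed {x} ρx≢x = [ ⊥-elim ∘ ρx≢x , (λ πx≡x → πx≡x) ]′ (ρ#π x)

  ρ-moved⇒g≡ρ : ∀ {x} → ρ ⟨$⟩ʳ x ≢ x → F x ≡ ρ ⟨$⟩ʳ x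
  ρ-moved⇒g≡ρ {x} ρx≢x = [ merged , split ]′ (toSum ω≈π?)
    where
    ρρx≢ρx : ρ ⟨$⟩ʳ (ρ ⟨$⟩ʳ x) ≢ ρ ⟨$⟩ʳ x
    ρρx≢ρx = ρx≢x ∘ Orbit.F-injective ρ
    merged : ω ≈ π → F x ≡ ρ ⟨$⟩ʳ x
    merged ω≈π = trans (g≈ρω ω≈π x) (ρ-moved⇒ω-fixed ρρx≢ρx)
    split : ¬ (ω ≈ π) → F x ≡ ρ ⟨$⟩ʳ x
    split ω≉π = trans (g≈ρωπ ω≉π x) (trans (cong (π ⟨$⟩ʳ_) (ρ-moved⇒ω-fixed ρρx≢ρx)) (ρ-moved⇒π-fixed ρρx≢ρx))

  ρ-fixes-orbit-L : ∀ {x} → L ⇝ x → ρ ⟨$⟩ʳ x ≡ x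
  ρ-fixes-orbit-L {x} r = decidable-stable (ρ ⟨$⟩ʳ x ≟ x) λ ρx≢x →
    ρx≢x (trans (sym (ρ-moved⇒g≡ρ ρx≢x)) (trans (sym (ω-on r)) (ρ-moved⇒ω-fixed ρx≢x)))

  ρ-fixes-orbit-b : ∀ {x} → b ⇝ x → ρ ⟨$⟩ʳ x ≡ x
  ρ-fixes-orbit-b {x} r = decidable-stable (ρ ⟨$⟩ʳ x ≟ x) λ ρx≢x →
    ρx≢x (trans (sym (ρ-moved⇒g≡ρ ρx≢x)) (trans (sym (π-on r)) (ρ-moved⇒π-fixed ρx≢x)))

  ρ-fixes-L : ρ ⟨$⟩ʳ L ≡ L
  ρ-fixes-L = ρ-fixes-orbit-L (orbit-refl L)

  Support : Fin (suc m) → Set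
  Support x = L ⇝ x ⊎ b ⇝ x

  support-step : ∀ {s} k → Support s → Support (iter F k s)
  support-step k (inj₁ r) = inj₁ (orbit-trans r (k , refl))
  support-step k (inj₂ r) = inj₂ (orbit-trans r (k , refl))

  ρ⁻¹-fixed : ∀ {x} → ρ ⟨$⟩ʳ x ≡ x → ρ ⟨$⟩ˡ x ≡ x
  ρ⁻¹-fixed ρx≡x = trans (cong (ρ ⟨$⟩ˡ_) (sym ρx≡x)) (inverseˡ ρ)

  ρ⁻¹-fixes-support : ∀ {x} → Support x → ρ ⟨$⟩ˡ x ≡ x
  ρ⁻¹-fixes-support = ρ⁻¹-fixed ∘ [ ρ-fixes-orbit-L , ρ-fixes-orbit-b ]′

  g-fixed-elsewhere : ∀ {x} → ρ ⟨$⟩ʳ x ≡ x → ¬ Support x → F x ≡ x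
  g-fixed-elsewhere {x} ρx≡x ¬s = [ merged , split ]′ (toSum ω≈π?)
    where
    ωx≡x : ω ⟨$⟩ʳ x ≡ x
    ωx≡x = ω-off (¬s ∘ inj₁)
    πx≡x : π ⟨$⟩ʳ x ≡ x
    πx≡x = π-off (¬s ∘ inj₂)
    merged : ω ≈ π → F x ≡ x
    merged ω≈π = trans (g≈ρω ω≈π x) (trans (cong (ω ⟨$⟩ʳ_) ρx≡x) ωx≡x)
    split : ¬ (ω ≈ π) → F x ≡ x
    split ω≉π = trans (g≈ρωπ ω≉π x)
                      (trans (cong (λ t → π ⟨$⟩ʳ (ω ⟨$⟩ʳ t)) ρx≡x) (trans (cong (π ⟨$⟩ʳ_) ωx≡x) πx≡x))

  ∣g∣-merged : ω ≈ π → ∣ g ∣ ≡ ∣ ρ ∣ + ∣ ω ∣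
  ∣g∣-merged ω≈π = trans (∣∣-cong g (ρ · ω) (g≈ρω ω≈π)) (∣∣-disjoint-product ρ ω ρ#ω)

  ∣g∣-split : ¬ (ω ≈ π) → ∣ g ∣ ≡ ∣ ρ ∣ + (∣ ω ∣ + ∣ π ∣)
  ∣g∣-split ω≉π = begin
    ∣ g ∣                   ≡⟨ ∣∣-cong g (ρ · ω · π) (g≈ρωπ ω≉π) ⟩
    ∣ ρ · ω · π ∣           ≡⟨ ∣∣-disjoint-product (ρ · ω) π ρω#π ⟩
    ∣ ρ · ω ∣ + ∣ π ∣       ≡⟨ cong (_+ ∣ π ∣) (∣∣-disjoint-product ρ ω ρ#ω) ⟩
    ∣ ρ ∣ + ∣ ω ∣ + ∣ π ∣   ≡⟨ ℕ.+-assoc (∣ ρ ∣) (∣ ω ∣) (∣ π ∣) ⟩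
    ∣ ρ ∣ + (∣ ω ∣ + ∣ π ∣) ∎
    where
    open ≡-Reasoning
    ρω#π : Disjoint (ρ · ω) π
    ρω#π x with ρ#π x | ω#π ω≉π x
    ... | inj₂ πx≡x | _         = inj₂ πx≡x
    ... | inj₁ _    | inj₂ πx≡x = inj₂ πx≡x
    ... | inj₁ ρx≡x | inj₁ ωx≡x = inj₁ (trans (cong (ω ⟨$⟩ʳ_) ρx≡x) ωx≡x)

  module Contracted (g′ : S m) (g′-contract : ∀ y → inject₁ (g′ ⟨$⟩ʳ y) ≡ H (inject₁ y)) where

    -- ρ fixes L, so remove last ρ is ρ on {0,…,n-2}.
    χ : S m
    χ = remove last ρ ⁻¹ · g′

    G : Fin (suc m) → Fin (suc m)
    G = embed χ

    G-last : G L ≡ L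
    G-last = embed-last χ

    embed-g′ : ∀ {x} → x ≢ L → embed g′ x ≡ H x
    embed-g′ {x} x≢L with inject₁-onto x x≢L
    ... | z , refl = trans (embed-inject₁ g′ z) (g′-contract z)

    G≡Hρ⁻¹ : ∀ {x} → x ≢ L → G x ≡ H (ρ ⟨$⟩ˡ x)
    G≡Hρ⁻¹ {x} x≢L with inject₁-onto x x≢L
    ... | z , refl = trans (embed-inject₁ χ z) (trans (g′-contract _) (cong H (inject₁-remove-last⁻¹ ρ ρ-fixes-L z)))

    G-support : ∀ {x} → x ≢ L → Support x → G x ≡ H x
    G-support x≢L s = trans (G≡Hρ⁻¹ x≢L) (cong H (ρ⁻¹-fixes-support s))

    H-ρ-moved : ∀ {w} → ρ ⟨$⟩ʳ w ≢ w → H w ≡ ρ ⟨$⟩ʳ w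
    H-ρ-moved {w} ρw≢w = trans (contractAt-other w≢b Fw≢L) (ρ-moved⇒g≡ρ ρw≢w)
      where
      w≢b : w ≢ b
      w≢b refl = ρw≢w (ρ-fixes-orbit-b (orbit-refl b))
      Fw≢L : F w ≢ L
      Fw≢L Fw≡L = ρw≢w (trans ρw≡L (sym w≡L))
        where
        ρw≡L : ρ ⟨$⟩ʳ w ≡ L
        ρw≡L = trans (sym (ρ-moved⇒g≡ρ ρw≢w)) Fw≡L
        w≡L : w ≡ L
        w≡L = Orbit.F-injective ρ (trans ρw≡L (sym ρ-fixes-L))

    G-ρ-moved : ∀ {x} → x ≢ L → ρ ⟨$⟩ʳ x ≢ x → G x ≡ x
    G-ρ-moved {x} x≢L ρx≢x = trans (G≡Hρ⁻¹ x≢L) (trans (H-ρ-moved ρw≢w) (inverseʳ ρ))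
      where
      ρw≢w : ρ ⟨$⟩ʳ (ρ ⟨$⟩ˡ x) ≢ ρ ⟨$⟩ˡ x
      ρw≢w ρw≡w = ρx≢x (trans (cong (ρ ⟨$⟩ʳ_) (sym w≡x)) (trans ρw≡w w≡x))
        where
        w≡x : ρ ⟨$⟩ˡ x ≡ x
        w≡x = trans (sym ρw≡w) (inverseʳ ρ)

    G-elsewhere : ∀ {x} → x ≢ L → ¬ Support x → G x ≡ x
    G-elsewhere {x} x≢L ¬s = [ ρ-fixed , G-ρ-moved x≢L ]′ (toSum (ρ ⟨$⟩ʳ x ≟ x))
      where
      ρ-fixed : ρ ⟨$⟩ʳ x ≡ x → G x ≡ x
      ρ-fixed ρx≡x = begin
        G x               ≡⟨ G≡Hρ⁻¹ x≢L ⟩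
        H (ρ ⟨$⟩ˡ x)      ≡⟨ cong H (ρ⁻¹-fixed ρx≡x) ⟩
        H x               ≡⟨ contractAt-other (λ { refl → ¬s (inj₂ (orbit-refl b)) }) (λ Fx≡L → x≢L (trans (sym Fx≡x) Fx≡L)) ⟩
        F x               ≡⟨ Fx≡x ⟩
        x                 ∎
        where
        open ≡-Reasoning
        Fx≡x : F x ≡ x
        Fx≡x = g-fixed-elsewhere ρx≡x ¬s

    G-moves⇒support : ∀ {x} → x ≢ L → G x ≢ x → Support x
    G-moves⇒support x≢L Gx≢x = decidable-stable (orbit? L _ ⊎-dec orbit? b _) (Gx≢x ∘ G-elsewhere x≢L)

    G#ρ : ∀ y → G y ≡ y ⊎ ρ ⟨$⟩ʳ y ≡ y
    G#ρ y = [ inj₂ , (λ ρy≢y → inj₁ (G-fixed ρy≢y)) ]′ (toSum (ρ ⟨$⟩ʳ y ≟ y))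
      where
      G-fixed : ρ ⟨$⟩ʳ y ≢ y → G y ≡ y
      G-fixed ρy≢y = [ (λ { refl → G-last }) , (λ y≢L → G-ρ-moved y≢L ρy≢y) ]′ (toSum (y ≟ L))

    conjugation : ∀ y → embed g′ y ≡ G (ρ ⟨$⟩ʳ y)
    conjugation y = [ at-L , off-L ]′ (toSum (y ≟ L))
      where
      at-L : y ≡ L → embed g′ y ≡ G (ρ ⟨$⟩ʳ y)
      at-L refl = trans (embed-last g′) (sym (trans (cong G ρ-fixes-L) G-last))
      off-L : y ≢ L → embed g′ y ≡ G (ρ ⟨$⟩ʳ y)
      off-L y≢L = trans (embed-g′ y≢L) (sym (trans (G≡Hρ⁻¹ ρy≢L) (cong H (inverseˡ ρ))))
        where
        ρy≢L : ρ ⟨$⟩ʳ y ≢ L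
        ρy≢L ρy≡L = y≢L (Orbit.F-injective ρ (trans ρy≡L (sym ρ-fixes-L)))

    ∣g′∣ : ∣ g′ ∣ ≡ ∣ ρ ∣ + ∣ χ ∣
    ∣g′∣ = begin
      ∣ g′ ∣                                     ≡⟨ ∣∣-embed g′ ⟩
      sum (movedEmbed g′)                        ≡⟨ sum-cong-≗ pointwise ⟩
      sum (λ x → moved ρ x + movedEmbed χ x)     ≡⟨ ∑-distrib-+ (moved ρ) (movedEmbed χ) ⟩
      sum (moved ρ) + sum (movedEmbed χ)         ≡⟨ cong₂ _+_ (∣∣-sum ρ) (∣∣-embed χ) ⟨
      ∣ ρ ∣ + ∣ χ ∣                              ∎
      where
      open ≡-Reasoning
      pointwise : ∀ x → movedEmbed g′ x ≡ moved ρ x + movedEmbed χ x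
      pointwise x = [ at-L , off-L ]′ (toSum (x ≟ L))
        where
        at-L : x ≡ L → movedEmbed g′ x ≡ moved ρ x + movedEmbed χ x
        at-L refl = trans (differ-≡ (embed-last g′)) (sym (cong₂ _+_ (differ-≡ ρ-fixes-L) (differ-≡ G-last)))
        off-L : x ≢ L → movedEmbed g′ x ≡ moved ρ x + movedEmbed χ x
        off-L x≢L = [ ρ-fixed , ρ-moved ]′ (toSum (ρ ⟨$⟩ʳ x ≟ x))
          where
          ρ-fixed : ρ ⟨$⟩ʳ x ≡ x → movedEmbed g′ x ≡ moved ρ x + movedEmbed χ x
          ρ-fixed ρx≡x = trans (cong (λ t → differ t x) g′x≡Gx) (cong (_+ movedEmbed χ x) (sym (differ-≡ ρx≡x)))
            where
            g′x≡Gx : embed g′ x ≡ G x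
            g′x≡Gx = trans (embed-g′ x≢L) (trans (cong H (sym (ρ⁻¹-fixed ρx≡x))) (sym (G≡Hρ⁻¹ x≢L)))
          ρ-moved : ρ ⟨$⟩ʳ x ≢ x → movedEmbed g′ x ≡ moved ρ x + movedEmbed χ x
          ρ-moved ρx≢x = trans (differ-≢ λ g′x≡x → ρx≢x (trans (sym (H-ρ-moved ρx≢x)) (trans (sym (embed-g′ x≢L)) g′x≡x)))
                               (sym (cong₂ _+_ (differ-≢ ρx≢x) (differ-≡ (G-ρ-moved x≢L ρx≢x))))

    -- The conclusion for hd(σ^CT, τ^CT) = hd(σ, τ) - k; these distances are ∣ g′ ∣ and ∣ g ∣.
    ClaimFor : ℕ → Set
    ClaimFor 0 = (ω ≈ id ⊎ π ≈ id) × IsCycle χ × ∣ χ ∣ ≡ ∣ ω · π ∣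
    ClaimFor 1 =
      (ω ≈ π →
         (IsCycle χ × ∣ χ ∣ + 1 ≡ ∣ ω ∣)
         ⊎ (∃₂ λ (ω′ π′ : S m) → IsCycle ω′ × IsCycle π′ × Disjoint ω′ π′
              × χ ≈ ω′ · π′ × ∣ ω′ ∣ + ∣ π′ ∣ + 1 ≡ ∣ ω ∣))
      × (¬ (ω ≈ π) → IsCycle χ × ∣ χ ∣ + 1 ≡ ∣ ω ∣ + ∣ π ∣)
    ClaimFor 2 = ω ≈ π × IsCycle χ × ∣ χ ∣ + 2 ≡ ∣ ω ∣
    ClaimFor 3 = ω ≈ π × ∣ ω ∣ ≡ 3 × χ ≈ id
    ClaimFor (suc (suc (suc (suc _)))) = ⊥

    Outcome : Set
    Outcome = ∃ λ k → ∣ g′ ∣ + k ≡ ∣ g ∣ × ClaimFor k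

    claim₁-merged : ω ≈ π → (IsCycle χ × ∣ χ ∣ + 1 ≡ ∣ ω ∣) ⊎ ProductOfTwoCycles χ (λ s → s + 1 ≡ ∣ ω ∣) →
                    ClaimFor 1
    claim₁-merged ω≈π claim = (λ _ → claim) , (λ ω≉π → ⊥-elim (ω≉π ω≈π))

    outcome-merged : ∀ k → ω ≈ π → ∣ χ ∣ + k ≡ ∣ ω ∣ → ClaimFor k → Outcome
    outcome-merged k ω≈π χ+k≡ω claim = k , size , claim
      where
      open ≡-Reasoning
      size : ∣ g′ ∣ + k ≡ ∣ g ∣
      size = begin
        ∣ g′ ∣ + k            ≡⟨ cong (_+ k) ∣g′∣ ⟩
        ∣ ρ ∣ + ∣ χ ∣ + k     ≡⟨ ℕ.+-assoc (∣ ρ ∣) (∣ χ ∣) k ⟩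
        ∣ ρ ∣ + (∣ χ ∣ + k)   ≡⟨ cong (∣ ρ ∣ +_) χ+k≡ω ⟩
        ∣ ρ ∣ + ∣ ω ∣         ≡⟨ ∣g∣-merged ω≈π ⟨
        ∣ g ∣                 ∎

    outcome-split : ∀ k → ¬ (ω ≈ π) → ∣ χ ∣ + k ≡ ∣ ω ∣ + ∣ π ∣ → ClaimFor k → Outcome
    outcome-split k ω≉π χ+k≡ω+π claim = k , size , claim
      where
      open ≡-Reasoning
      size : ∣ g′ ∣ + k ≡ ∣ g ∣
      size = begin
        ∣ g′ ∣ + k              ≡⟨ cong (_+ k) ∣g′∣ ⟩
        ∣ ρ ∣ + ∣ χ ∣ + k       ≡⟨ ℕ.+-assoc (∣ ρ ∣) (∣ χ ∣) k ⟩
        ∣ ρ ∣ + (∣ χ ∣ + k)     ≡⟨ cong (∣ ρ ∣ +_) χ+k≡ω+π ⟩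
        ∣ ρ ∣ + (∣ ω ∣ + ∣ π ∣) ≡⟨ ∣g∣-split ω≉π ⟨
        ∣ g ∣                   ∎

    _⇝G_ : Fin (suc m) → Fin (suc m) → Set
    s ⇝G x = ∃ λ k → iter G k s ≡ x

    ⇝G-trans : ∀ {a x y} → a ⇝G x → x ⇝G y → a ⇝G y
    ⇝G-trans {a} (k , refl) (j , refl) = j + k , iter-+ G j k a

    ⇝G-orbit : ∀ {u z} → inject₁ u ⇝G inject₁ z → InOrbit χ u z
    ⇝G-orbit {u} (k , Gᵏu≡z) = k , inject₁-injective (trans (sym (iter-embed χ k u)) Gᵏu≡z)

    G-moves : ∀ {z} → Moves χ z → G (inject₁ z) ≢ inject₁ z
    G-moves {z} χz≢z Gz≡z = χz≢z (inject₁-injective (trans (sym (embed-inject₁ χ z)) Gz≡z))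

    isCycle-hub : ∀ u → u ≢ L → (∀ x → x ≢ L → G x ≢ x → u ⇝G x) → IsCycle χ
    isCycle-hub u u≢L hub with inject₁-onto u u≢L
    ... | u′ , refl = Cycles.isCycle-hub χ u′ λ z χz≢z → ⇝G-orbit (hub (inject₁ z) (inject₁≢last z) (G-moves χz≢z))

    χ≈id : (∀ x → x ≢ L → G x ≡ x) → χ ≈ id
    χ≈id G-fixes z = inject₁-injective (trans (sym (embed-inject₁ χ z)) (G-fixes (inject₁ z) (inject₁≢last z)))

    ∣ω∣-pointwise : ∀ {k : Fin (suc m) → ℕ} → (∀ x → moved ω x ≡ movedEmbed χ x + k x) → ∣ ω ∣ ≡ ∣ χ ∣ + sum k
    ∣ω∣-pointwise {k} pointwise = begin
      ∣ ω ∣                               ≡⟨ ∣∣-sum ω ⟩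
      sum (moved ω)                       ≡⟨ sum-cong-≗ pointwise ⟩
      sum (λ x → movedEmbed χ x + k x)    ≡⟨ ∑-distrib-+ (movedEmbed χ) k ⟩
      sum (movedEmbed χ) + sum k          ≡⟨ cong (_+ sum k) (∣∣-embed χ) ⟨
      ∣ χ ∣ + sum k                       ∎
      where open ≡-Reasoning

    sum-δ₂ : ∀ (a a′ : Fin (suc m)) → sum (λ x → δ x a + δ x a′) ≡ 2
    sum-δ₂ a a′ = trans (∑-distrib-+ (λ x → δ x a) (λ x → δ x a′)) (cong₂ _+_ (sum-δ a) (sum-δ a′))

    -- G can differ from g on the support only at these points.
    Stop : Fin (suc m) → Set
    Stop y = y ≡ L ⊎ (y ≡ b ⊎ F y ≡ L)

    Stop? : ∀ y → Dec (Stop y)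
    Stop? y = (y ≟ L) ⊎-dec ((y ≟ b) ⊎-dec (F y ≟ L))

    Path : Fin (suc m) → ℕ → Set
    Path s j = ∀ i → i < j → ¬ Stop (iter F i s)

    Seg : Fin (suc m) → ℕ → Fin (suc m) → Set
    Seg s j x = ∃ λ i → i ≤ j × iter F i s ≡ x

    G-off-stops : ∀ {y} → Support y → ¬ Stop y → G y ≡ F y
    G-off-stops s ¬stop = trans (G-support (¬stop ∘ inj₁) s) (contractAt-other (¬stop ∘ inj₂ ∘ inj₁) (¬stop ∘ inj₂ ∘ inj₂))

    seg⇒⇝G : ∀ {s j x} → Support s → Path s j → Seg s j x → s ⇝G x
    seg⇒⇝G {s} {j} supp path (i , i≤j , Fⁱs≡x) =
      i , trans (iter-agree G s j (λ i i<j → G-off-stops (support-step i supp) (path i i<j)) i i≤j) Fⁱs≡x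

    -- Abstract, like orbit?, so that goals never unfold the search.
    abstract
      first-stop : ∀ {s y} → s ⇝ y → Stop y → ∃ λ j → Stop (iter F j s) × Path s j
      first-stop {s} (k , refl) stop = leastWitness (λ i → Stop? (iter F i s)) k stop

    path-start : ∀ {s j p} → Path s j → F p ≡ iter F j s → Stop p → j ≡ 0
    path-start {j = zero}      path Fp≡Fʲs stop = refl
    path-start {s} {suc j} {p} path Fp≡Fʲs stop = ⊥-elim (path j (ℕ.n<1+n j) (subst Stop (F-injective Fp≡Fʲs) stop))

    path-to-L : ∀ {s j} → Path s j → iter F j s ≡ L → s ≡ L
    path-to-L path Fʲs≡L with path-start {p = e} path (trans F-e (sym Fʲs≡L)) (inj₂ (inj₂ F-e))
    ... | refl = Fʲs≡L

    seg-start : ∀ {s j} → Seg s j s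
    seg-start = 0 , z≤n , refl

    seg-end : ∀ {s j} → Seg s j (iter F j s)
    seg-end {j = j} = j , ℕ.≤-refl , refl

    seg-step : ∀ {s j x} → Seg s j x → x ≢ iter F j s → Seg s j (F x)
    seg-step {j = j} (i , i≤j , Fⁱs≡x) x≢Fʲs with ℕ.m≤n⇒m<n∨m≡n i≤j
    ... | inj₁ i<j  = suc i , i<j , cong F Fⁱs≡x
    ... | inj₂ refl = ⊥-elim (x≢Fʲs (sym Fⁱs≡x))

    G-moves-on-orbit : F L ≢ L → ∀ {x} → x ≢ L → L ⇝ x → x ≢ b → (F x ≡ L → c ≢ x) → G x ≢ x
    G-moves-on-orbit FL≢L {x} x≢L r x≢b c≢x Gx≡x = [ into-L , other ]′ (toSum (F x ≟ L))
      where
      Hx≡x : H x ≡ x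
      Hx≡x = trans (sym (G-support x≢L (inj₁ r))) Gx≡x
      into-L : F x ≡ L → ⊥
      into-L Fx≡L = c≢x Fx≡L (trans (sym (contractAt-into-last x≢b Fx≡L)) Hx≡x)
      other : F x ≢ L → ⊥
      other Fx≢L = FL≢L (fixed-on-orbit r (trans (sym (contractAt-other x≢b Fx≢L)) Hx≡x))

    -- When the support is the cycle of L: ω moves L, every point G moves, and the points κ that G fixes.
    ∣ω∣-lost : F L ≢ L → (∀ {x} → Support x → L ⇝ x) → (κ : Fin (suc m) → ℕ) → κ L ≡ 0 →
               (∀ x → ¬ L ⇝ x → κ x ≡ 0) → (∀ x → x ≢ L → L ⇝ x → movedEmbed χ x + κ x ≡ 1) →
               ∣ ω ∣ ≡ ∣ χ ∣ + (1 + sum κ)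
    ∣ω∣-lost FL≢L support⊆ κ κL≡0 κ-off κ-on =
      trans (∣ω∣-pointwise pointwise) (cong (∣ χ ∣ +_) (trans (∑-distrib-+ (λ x → δ x L) κ) (cong (_+ sum κ) (sum-δ L))))
      where
      pointwise : ∀ x → moved ω x ≡ movedEmbed χ x + (δ x L + κ x)
      pointwise x = [ at-L , (λ x≢L → [ on-orbit x≢L , off-orbit x≢L ]′ (toSum (orbit? L x))) ]′ (toSum (x ≟ L))
        where
        at-L : x ≡ L → moved ω x ≡ movedEmbed χ x + (δ x L + κ x)
        at-L refl = trans (differ-≢ (ω-moves (orbit-refl L) FL≢L))
                          (sym (cong₂ _+_ (differ-≡ G-last) (cong₂ _+_ (δ-≡ {x = L} refl) κL≡0)))
        on-orbit : x ≢ L → L ⇝ x → moved ω x ≡ movedEmbed χ x + (δ x L + κ x)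
        on-orbit x≢L r = trans (differ-≢ (ω-moves r FL≢L))
                               (sym (trans (cong (λ t → movedEmbed χ x + (t + κ x)) (δ-≢ x≢L)) (κ-on x x≢L r)))
        off-orbit : x ≢ L → ¬ L ⇝ x → moved ω x ≡ movedEmbed χ x + (δ x L + κ x)
        off-orbit x≢L ¬r = trans (differ-≡ (ω-off ¬r))
                                 (sym (cong₂ _+_ (differ-≡ (G-elsewhere x≢L (¬r ∘ support⊆))) (cong₂ _+_ (δ-≢ x≢L) (κ-off x ¬r))))

    seg-at-stop : ∀ {s j x} → Stop s → Path s j → Seg s j x → x ≡ s
    seg-at-stop stop path (zero  , _     , refl) = refl
    seg-at-stop stop path (suc i , 1+i≤j , _)    = ⊥-elim (path 0 (ℕ.≤-<-trans z≤n 1+i≤j) stop)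

    module WalkD (FL≢L : F L ≢ L) where

      private
        walk = first-stop (orbit-sym (orbit-F L)) (inj₁ refl)

      j : ℕ
      j = proj₁ walk

      path : Path d j
      path = proj₂ (proj₂ walk)

      y : Fin (suc m)
      y = iter F j d

      L⇝y : L ⇝ y
      L⇝y = orbit-trans (orbit-F L) (j , refl)

      ends-at-b-or-e : y ≡ b ⊎ F y ≡ L
      ends-at-b-or-e = [ (λ y≡L → ⊥-elim (FL≢L (path-to-L path y≡L))) , (λ end → end) ]′ (proj₁ (proj₂ walk))

      -- Once the walk has reached e, it has traversed the whole cycle of L.
      walk-covers-orbit : F y ≡ L → ∀ {x} → L ⇝ x → x ≡ L ⊎ Seg d j x
      walk-covers-orbit Fy≡L = orbit-induction (λ x → x ≡ L ⊎ Seg d j x) (inj₁ refl) step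
        where
        step : ∀ z → z ≡ L ⊎ Seg d j z → F z ≡ L ⊎ Seg d j (F z)
        step z (inj₁ refl) = inj₂ seg-start
        step z (inj₂ seg)  = [ (λ { refl → inj₁ Fy≡L }) , inj₂ ∘ seg-step seg ]′ (toSum (z ≟ y))

      walk-hub : F y ≡ L → ∀ {x} → x ≢ L → L ⇝ x → d ⇝G x
      walk-hub Fy≡L x≢L r = [ ⊥-elim ∘ x≢L , seg⇒⇝G (inj₁ (orbit-F L)) path ]′ (walk-covers-orbit Fy≡L r)

    trivial : F L ≡ L → ω ≈ π → (∀ x → x ≢ L → G x ≡ x) → Outcome
    trivial FL≡L ω≈π G-fixes =
      outcome-merged 0 ω≈π (trans (ℕ.+-identityʳ _) (trans ∣χ∣≡0 (sym (∣∣-id ω ω≈id′))))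
        (inj₁ ω≈id′ , isCycle-id χ χ≈id′ , trans ∣χ∣≡0 (sym (∣∣-id (ω · π) ωπ≈id)))
      where
      ω≈id′ : ω ≈ id
      ω≈id′ = ω≈id FL≡L
      χ≈id′ : χ ≈ id
      χ≈id′ = χ≈id G-fixes
      ∣χ∣≡0 : ∣ χ ∣ ≡ 0
      ∣χ∣≡0 = ∣∣-id χ χ≈id′
      ωπ≈id : ω · π ≈ id
      ωπ≈id x = trans (cong (π ⟨$⟩ʳ_) (ω≈id′ x)) (trans (sym (ω≈π x)) (ω≈id′ x))

    -- b = L: g′ is g with L deleted from its cycle

    module AtLast (b≡L : b ≡ L) where

      support⊆ : ∀ {x} → Support x → L ⇝ x
      support⊆ = [ (λ r → r) , subst (_⇝ _) b≡L ]′

      ω≈π : ω ≈ π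
      ω≈π = orbits-meet (orbit-refl L) (subst (_⇝ L) (sym b≡L) (orbit-refl L))

      fixed : F L ≡ L → Outcome
      fixed FL≡L = trivial FL≡L ω≈π λ x x≢L → G-elsewhere x≢L (λ s → x≢L (orbit-of-fixed FL≡L (support⊆ s)))

      transposition : F L ≢ L → F d ≡ L → Outcome
      transposition FL≢L Fd≡L =
        outcome-merged 2 ω≈π (sym ∣ω∣≡∣χ∣+2) (ω≈π , isCycle-id χ χ≈id′ , sym ∣ω∣≡∣χ∣+2)
        where
        d≢L : d ≢ L
        d≢L = FL≢L
        cover : ∀ {x} → L ⇝ x → x ≡ L ⊎ x ≡ d
        cover = orbit-induction (λ x → x ≡ L ⊎ x ≡ d) (inj₁ refl)
                  λ { y (inj₁ refl) → inj₂ refl ; y (inj₂ refl) → inj₁ Fd≡L }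
        Gd≡d : G d ≡ d
        Gd≡d = trans (G-support d≢L (inj₁ (orbit-F L)))
                     (trans (contractAt-into-last (λ d≡b → d≢L (trans d≡b b≡L)) Fd≡L) (cong F b≡L))
        G-fixes : ∀ x → x ≢ L → G x ≡ x
        G-fixes x x≢L = [ (λ r → [ ⊥-elim ∘ x≢L , (λ { refl → Gd≡d }) ]′ (cover r))
                        , (λ ¬r → G-elsewhere x≢L (¬r ∘ support⊆)) ]′ (toSum (orbit? L x))
        χ≈id′ : χ ≈ id
        χ≈id′ = χ≈id G-fixes
        ∣ω∣≡∣χ∣+2 : ∣ ω ∣ ≡ ∣ χ ∣ + 2
        ∣ω∣≡∣χ∣+2 = trans (∣ω∣-lost FL≢L support⊆ (λ x → δ x d) (δ-≢ (d≢L ∘ sym))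
                                    (λ x ¬r → δ-≢ {x = x} λ { refl → ¬r (orbit-F L) }) on-orbit)
                          (cong (λ t → ∣ χ ∣ + (1 + t)) (sum-δ d))
          where
          on-orbit : ∀ x → x ≢ L → L ⇝ x → movedEmbed χ x + δ x d ≡ 1
          on-orbit x x≢L r = [ ⊥-elim ∘ x≢L , (λ { refl → cong₂ _+_ (differ-≡ Gd≡d) (δ-≡ {x = d} refl) }) ]′ (cover r)

      long : F L ≢ L → F d ≢ L → Outcome
      long FL≢L Fd≢L =
        outcome-merged 1 ω≈π (sym ∣ω∣≡∣χ∣+1) (claim₁-merged ω≈π (inj₁ (isCycle-hub d FL≢L hub′ , sym ∣ω∣≡∣χ∣+1)))
        where
        open WalkD FL≢L
        Fy≡L : F y ≡ L
        Fy≡L = [ (λ y≡b → ⊥-elim (FL≢L (path-to-L path (trans y≡b b≡L)))) , (λ Fy≡L → Fy≡L) ]′ ends-at-b-or-e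
        hub′ : ∀ x → x ≢ L → G x ≢ x → d ⇝G x
        hub′ x x≢L Gx≢x = walk-hub Fy≡L x≢L (support⊆ (G-moves⇒support x≢L Gx≢x))
        on-orbit : ∀ x → x ≢ L → L ⇝ x → movedEmbed χ x + 0 ≡ 1
        on-orbit x x≢L r = trans (ℕ.+-identityʳ _) (differ-≢ (G-moves-on-orbit FL≢L x≢L r (λ x≡b → x≢L (trans x≡b b≡L)) c≢x))
          where
          c≢x : F x ≡ L → c ≢ x
          c≢x Fx≡L c≡x = Fd≢L (trans (cong F (trans (sym (cong F b≡L)) c≡x)) Fx≡L)
        ∣ω∣≡∣χ∣+1 : ∣ ω ∣ ≡ ∣ χ ∣ + 1
        ∣ω∣≡∣χ∣+1 = trans (∣ω∣-lost FL≢L support⊆ (λ _ → 0) refl (λ _ _ → refl) on-orbit)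
                          (cong (λ t → ∣ χ ∣ + (1 + t)) (sum-zero {suc m} (λ _ → refl)))

      outcome : Outcome
      outcome = [ fixed , (λ FL≢L → [ transposition FL≢L , long FL≢L ]′ (toSum (F d ≟ L))) ]′ (toSum (F L ≟ L))

    -- b outside the cycle of L: g′ merges the two cycles

    module Apart (¬L⇝b : ¬ L ⇝ b) where

      b≢L : b ≢ L
      b≢L refl = ¬L⇝b (orbit-refl L)

      apart : ∀ {x} → L ⇝ x → ¬ b ⇝ x
      apart L⇝x b⇝x = ¬L⇝b (orbit-trans L⇝x (orbit-sym b⇝x))

      ω≉π-at-b : F b ≢ b → ¬ (ω ≈ π)
      ω≉π-at-b Fb≢b ω≈π = Fb≢b (trans (sym (π-on (orbit-refl b))) (trans (sym (ω≈π b)) (ω-off ¬L⇝b)))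

      ω≉π-at-L : F L ≢ L → ¬ (ω ≈ π)
      ω≉π-at-L FL≢L ω≈π = FL≢L (trans (sym (ω-on (orbit-refl L))) (trans (ω≈π L) (π-off (apart (orbit-refl L)))))

      G-moves-orbit-L : ∀ {x} → x ≢ L → L ⇝ x → G x ≢ x
      G-moves-orbit-L {x} x≢L r =
        G-moves-on-orbit FL≢L x≢L r (λ { refl → ¬L⇝b r }) (λ _ c≡x → apart r (subst (b ⇝_) c≡x (orbit-F b)))
        where
        FL≢L : F L ≢ L
        FL≢L FL≡L = x≢L (orbit-of-fixed FL≡L r)

      G-orbit-b : ∀ {x} → x ≢ b → b ⇝ x → G x ≡ F x
      G-orbit-b {x} x≢b r = trans (G-support (λ { refl → apart (orbit-refl L) r }) (inj₂ r)) (contractAt-other x≢b Fx≢L)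
        where
        Fx≢L : F x ≢ L
        Fx≢L Fx≡L = apart (subst (L ⇝_) (sym (into-L⇒e Fx≡L)) L⇝e) r

      G-b : G b ≡ H b
      G-b = G-support b≢L (inj₂ (orbit-refl b))

      moved-off : ∀ {x} → x ≢ L → ¬ L ⇝ x → ¬ b ⇝ x → movedEmbed χ x ≡ 0 × moved ω x ≡ 0 × moved π x ≡ 0
      moved-off x≢L ¬r ¬r′ = differ-≡ (G-elsewhere x≢L [ ¬r , ¬r′ ]′) , differ-≡ (ω-off ¬r) , differ-≡ (π-off ¬r′)

      G-b-moved : F L ≢ L → G b ≢ b
      G-b-moved FL≢L Gb≡b = ¬L⇝b (subst (L ⇝_) (trans (sym (contractAt-b-moved FL≢L)) (trans (sym G-b) Gb≡b)) (orbit-F L))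

      both-fixed : F L ≡ L → F b ≡ b → Outcome
      both-fixed FL≡L Fb≡b = trivial FL≡L (λ x → trans (ω≈id FL≡L x) (sym (π≈id Fb≡b x))) G-fixes
        where
        G-fixes : ∀ x → x ≢ L → G x ≡ x
        G-fixes x x≢L = [ ⊥-elim ∘ x≢L ∘ orbit-of-fixed FL≡L
                        , (λ ¬r → [ (λ r′ → subst (λ t → G t ≡ t) (sym (orbit-of-fixed Fb≡b r′)) Gb≡b)
                                  , (λ ¬r′ → G-elsewhere x≢L [ ¬r , ¬r′ ]′) ]′ (toSum (orbit? b x))) ]′ (toSum (orbit? L x))
          where
          Gb≡b : G b ≡ b
          Gb≡b = trans G-b (trans (contractAt-b-fixed FL≡L) Fb≡b)

      L-fixed : F L ≡ L → F b ≢ b → Outcome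
      L-fixed FL≡L Fb≢b =
        outcome-split 0 (ω≉π-at-b Fb≢b) (trans (ℕ.+-identityʳ _) (trans ∣χ∣≡∣π∣ (cong (_+ ∣ π ∣) (sym (∣∣-id ω ω≈id′)))))
          (inj₁ ω≈id′ , isCycle-hub b b≢L hub , trans ∣χ∣≡∣π∣ (sym ∣ωπ∣≡∣π∣))
        where
        ω≈id′ : ω ≈ id
        ω≈id′ = ω≈id FL≡L
        ∣ωπ∣≡∣π∣ : ∣ ω · π ∣ ≡ ∣ π ∣
        ∣ωπ∣≡∣π∣ = ∣∣-cong (ω · π) π (λ x → cong (π ⟨$⟩ʳ_) (ω≈id′ x))
        G≡F : ∀ {x} → b ⇝ x → G x ≡ F x
        G≡F {x} r = [ (λ { refl → trans G-b (contractAt-b-fixed FL≡L) }) , (λ x≢b → G-orbit-b x≢b r) ]′ (toSum (x ≟ b))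
        hub : ∀ x → x ≢ L → G x ≢ x → b ⇝G x
        hub x x≢L Gx≢x = [ ⊥-elim ∘ x≢L ∘ orbit-of-fixed FL≡L , along-b ]′ (G-moves⇒support x≢L Gx≢x)
          where
          along-b : b ⇝ x → b ⇝G x
          along-b (k , refl) = k , iter-agree G b k (λ i _ → G≡F (i , refl)) k ℕ.≤-refl
        pointwise : ∀ x → movedEmbed χ x ≡ moved π x
        pointwise x = [ on , off ]′ (toSum (orbit? b x))
          where
          on : b ⇝ x → movedEmbed χ x ≡ moved π x
          on r = cong (λ t → differ t x) (trans (G≡F r) (sym (π-on r)))
          off : ¬ b ⇝ x → movedEmbed χ x ≡ moved π x
          off ¬r′ = trans (differ-≡ ([ (λ { refl → G-last }) , G-fixed ]′ (toSum (x ≟ L)))) (sym (differ-≡ (π-off ¬r′)))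
            where
            G-fixed : x ≢ L → G x ≡ x
            G-fixed x≢L = G-elsewhere x≢L [ x≢L ∘ orbit-of-fixed FL≡L , ¬r′ ]′
        ∣χ∣≡∣π∣ : ∣ χ ∣ ≡ ∣ π ∣
        ∣χ∣≡∣π∣ = trans (∣∣-embed χ) (trans (sum-cong-≗ pointwise) (sym (∣∣-sum π)))

      module WalkDToE (FL≢L : F L ≢ L) where
        open WalkD FL≢L public

        Fy≡L : F y ≡ L
        Fy≡L = [ (λ y≡b → ⊥-elim (¬L⇝b (subst (L ⇝_) y≡b L⇝y))) , (λ Fy≡L → Fy≡L) ]′ ends-at-b-or-e

        Gy≡c : G y ≡ c
        Gy≡c = trans (G-support (λ y≡L → FL≢L (trans (cong F (sym y≡L)) Fy≡L)) (inj₁ L⇝y))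
                     (contractAt-into-last (λ y≡b → ¬L⇝b (subst (L ⇝_) y≡b L⇝y)) Fy≡L)

        d⇝Gc : d ⇝G c
        d⇝Gc = ⇝G-trans (seg⇒⇝G (inj₁ (orbit-F L)) path seg-end) (1 , Gy≡c)

      b-fixed : F L ≢ L → F b ≡ b → Outcome
      b-fixed FL≢L Fb≡b =
        outcome-split 0 (ω≉π-at-L FL≢L) (trans (ℕ.+-identityʳ _) (trans ∣χ∣≡∣ω∣ (sym ∣ω∣+∣π∣≡∣ω∣)))
          (inj₂ π≈id′ , isCycle-hub d FL≢L hub′ , trans ∣χ∣≡∣ω∣ (sym ∣ωπ∣≡∣ω∣))
        where
        open WalkDToE FL≢L
        π≈id′ : π ≈ id
        π≈id′ = π≈id Fb≡b
        ∣ω∣+∣π∣≡∣ω∣ : ∣ ω ∣ + ∣ π ∣ ≡ ∣ ω ∣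
        ∣ω∣+∣π∣≡∣ω∣ = trans (cong (∣ ω ∣ +_) (∣∣-id π π≈id′)) (ℕ.+-identityʳ _)
        ∣ωπ∣≡∣ω∣ : ∣ ω · π ∣ ≡ ∣ ω ∣
        ∣ωπ∣≡∣ω∣ = ∣∣-cong (ω · π) ω (λ x → π≈id′ (ω ⟨$⟩ʳ x))
        hub′ : ∀ x → x ≢ L → G x ≢ x → d ⇝G x
        hub′ x x≢L Gx≢x = [ walk-hub Fy≡L x≢L , (λ r′ → subst (d ⇝G_) (sym (orbit-of-fixed Fb≡b r′)) d⇝Gb) ]′
                            (G-moves⇒support x≢L Gx≢x)
          where
          d⇝Gb : d ⇝G b
          d⇝Gb = subst (d ⇝G_) Fb≡b d⇝Gc
        -- b takes the place of L in the cycle of χ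
        pointwise : ∀ x → moved ω x + δ x b ≡ movedEmbed χ x + δ x L
        pointwise x = [ at-L , (λ x≢L → [ at-b x≢L , (λ x≢b → [ on x≢L , off x≢L x≢b ]′ (toSum (orbit? L x))) ]′ (toSum (x ≟ b))) ]′
                        (toSum (x ≟ L))
          where
          at-L : x ≡ L → moved ω x + δ x b ≡ movedEmbed χ x + δ x L
          at-L refl = trans (cong₂ _+_ (differ-≢ (ω-moves (orbit-refl L) FL≢L)) (δ-≢ (b≢L ∘ sym)))
                            (sym (cong₂ _+_ (differ-≡ G-last) (δ-≡ {x = L} refl)))
          at-b : x ≢ L → x ≡ b → moved ω x + δ x b ≡ movedEmbed χ x + δ x L
          at-b x≢L refl = trans (cong₂ _+_ (differ-≡ (ω-off ¬L⇝b)) (δ-≡ {x = b} refl))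
                                (sym (cong₂ _+_ (differ-≢ (G-b-moved FL≢L)) (δ-≢ x≢L)))
          on : x ≢ L → L ⇝ x → moved ω x + δ x b ≡ movedEmbed χ x + δ x L
          on x≢L r = trans (cong₂ _+_ (differ-≢ (ω-moves r FL≢L)) (δ-≢ {x = x} (λ { refl → ¬L⇝b r })))
                           (sym (cong₂ _+_ (differ-≢ (G-moves-orbit-L x≢L r)) (δ-≢ x≢L)))
          off : x ≢ L → x ≢ b → ¬ L ⇝ x → moved ω x + δ x b ≡ movedEmbed χ x + δ x L
          off x≢L x≢b ¬r = trans (cong₂ _+_ (proj₁ (proj₂ zeros)) (δ-≢ x≢b)) (sym (cong₂ _+_ (proj₁ zeros) (δ-≢ x≢L)))
            where
            zeros : movedEmbed χ x ≡ 0 × moved ω x ≡ 0 × moved π x ≡ 0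
            zeros = moved-off x≢L ¬r (x≢b ∘ orbit-of-fixed Fb≡b)
        ∣χ∣≡∣ω∣ : ∣ χ ∣ ≡ ∣ ω ∣
        ∣χ∣≡∣ω∣ = ℕ.+-cancelʳ-≡ 1 _ _ (begin
          ∣ χ ∣ + 1                           ≡⟨ cong₂ _+_ (∣∣-embed χ) (sym (sum-δ L)) ⟩
          sum (movedEmbed χ) + sum (λ x → δ x L) ≡⟨ sum-cong-+ (moved ω) (λ x → δ x b) (movedEmbed χ) (λ x → δ x L) pointwise ⟨
          sum (moved ω) + sum (λ x → δ x b)   ≡⟨ cong₂ _+_ (∣∣-sum ω) (sym (sum-δ b)) ⟨
          ∣ ω ∣ + 1                           ∎)
          where open ≡-Reasoning

      both-moved : F L ≢ L → F b ≢ b → Outcome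
      both-moved FL≢L Fb≢b =
        outcome-split 1 ω≉π ∣χ∣+1≡∣ω∣+∣π∣ (⊥-elim ∘ ω≉π , (λ _ → isCycle-hub d FL≢L hub′ , ∣χ∣+1≡∣ω∣+∣π∣))
        where
        open WalkDToE FL≢L
        ω≉π : ¬ (ω ≈ π)
        ω≉π = ω≉π-at-L FL≢L
        walk-c = first-stop (orbit-sym (orbit-F b)) (inj₂ (inj₁ refl))
        j′ = proj₁ walk-c
        path′ : Path c j′
        path′ = proj₂ (proj₂ walk-c)
        y′ = iter F j′ c
        b⇝y′ : b ⇝ y′
        b⇝y′ = orbit-trans (orbit-F b) (j′ , refl)
        y′≡b : y′ ≡ b
        y′≡b = [ (λ y′≡L → ⊥-elim (apart (orbit-refl L) (subst (b ⇝_) y′≡L b⇝y′)))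
               , [ (λ y′≡b → y′≡b) , (λ Fy′≡L → ⊥-elim (apart (subst (L ⇝_) (sym (into-L⇒e Fy′≡L)) L⇝e) b⇝y′)) ]′ ]′
               (proj₁ (proj₂ walk-c))
        cover-b : ∀ {x} → b ⇝ x → Seg c j′ x
        cover-b = orbit-induction (Seg c j′) (j′ , ℕ.≤-refl , y′≡b) step
          where
          step : ∀ z → Seg c j′ z → Seg c j′ (F z)
          step z seg = [ (λ { refl → subst (λ t → Seg c j′ (F t)) (sym y′≡b) seg-start }) , seg-step seg ]′ (toSum (z ≟ y′))
        hub′ : ∀ x → x ≢ L → G x ≢ x → d ⇝G x
        hub′ x x≢L Gx≢x = [ walk-hub Fy≡L x≢L , (λ r′ → ⇝G-trans d⇝Gc (seg⇒⇝G (inj₂ (orbit-F b)) path′ (cover-b r′))) ]′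
                            (G-moves⇒support x≢L Gx≢x)
        G-moves-orbit-b : ∀ {x} → b ⇝ x → G x ≢ x
        G-moves-orbit-b {x} r′ = [ (λ { refl → G-b-moved FL≢L }) , off-b ]′ (toSum (x ≟ b))
          where
          off-b : x ≢ b → G x ≢ x
          off-b x≢b Gx≡x = Fb≢b (fixed-on-orbit r′ (trans (sym (G-orbit-b x≢b r′)) Gx≡x))
        -- L is the only point lost by merging the two cycles
        pointwise : ∀ x → moved ω x + moved π x ≡ movedEmbed χ x + δ x L
        pointwise x = [ at-L , (λ x≢L → [ on-L x≢L , (λ ¬r → [ on-b x≢L ¬r , off x≢L ¬r ]′ (toSum (orbit? b x))) ]′ (toSum (orbit? L x))) ]′
                        (toSum (x ≟ L))
          where
          at-L : x ≡ L → moved ω x + moved π x ≡ movedEmbed χ x + δ x L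
          at-L refl = trans (cong₂ _+_ (differ-≢ (ω-moves (orbit-refl L) FL≢L)) (differ-≡ (π-off (apart (orbit-refl L)))))
                            (sym (cong₂ _+_ (differ-≡ G-last) (δ-≡ {x = L} refl)))
          on-L : x ≢ L → L ⇝ x → moved ω x + moved π x ≡ movedEmbed χ x + δ x L
          on-L x≢L r = trans (cong₂ _+_ (differ-≢ (ω-moves r FL≢L)) (differ-≡ (π-off (apart r))))
                             (sym (cong₂ _+_ (differ-≢ (G-moves-orbit-L x≢L r)) (δ-≢ x≢L)))
          on-b : x ≢ L → ¬ L ⇝ x → b ⇝ x → moved ω x + moved π x ≡ movedEmbed χ x + δ x L
          on-b x≢L ¬r r′ = trans (cong₂ _+_ (differ-≡ (ω-off ¬r)) (differ-≢ (π-moves r′ Fb≢b)))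
                                 (sym (cong₂ _+_ (differ-≢ (G-moves-orbit-b r′)) (δ-≢ x≢L)))
          off : x ≢ L → ¬ L ⇝ x → ¬ b ⇝ x → moved ω x + moved π x ≡ movedEmbed χ x + δ x L
          off x≢L ¬r ¬r′ = trans (cong₂ _+_ (proj₁ (proj₂ zeros)) (proj₂ (proj₂ zeros)))
                                 (sym (cong₂ _+_ (proj₁ zeros) (δ-≢ x≢L)))
            where
            zeros : movedEmbed χ x ≡ 0 × moved ω x ≡ 0 × moved π x ≡ 0
            zeros = moved-off x≢L ¬r ¬r′
        ∣χ∣+1≡∣ω∣+∣π∣ : ∣ χ ∣ + 1 ≡ ∣ ω ∣ + ∣ π ∣
        ∣χ∣+1≡∣ω∣+∣π∣ = begin
          ∣ χ ∣ + 1                              ≡⟨ cong₂ _+_ (∣∣-embed χ) (sym (sum-δ L)) ⟩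
          sum (movedEmbed χ) + sum (λ x → δ x L) ≡⟨ sum-cong-+ (moved ω) (moved π) (movedEmbed χ) (λ x → δ x L) pointwise ⟨
          sum (moved ω) + sum (moved π)          ≡⟨ cong₂ _+_ (∣∣-sum ω) (∣∣-sum π) ⟨
          ∣ ω ∣ + ∣ π ∣                          ∎
          where open ≡-Reasoning

      outcome : Outcome
      outcome = [ (λ FL≡L → [ both-fixed FL≡L , L-fixed FL≡L ]′ (toSum (F b ≟ b)))
                , (λ FL≢L → [ b-fixed FL≢L , both-moved FL≢L ]′ (toSum (F b ≟ b))) ]′ (toSum (F L ≟ L))

    -- b on the cycle of L: g′ splits that cycle into (d … b) and (c … e), minus L

    module Split (b≢L : b ≢ L) (L⇝b : L ⇝ b) where

      FL≢L : F L ≢ L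
      FL≢L FL≡L = b≢L (orbit-of-fixed FL≡L L⇝b)

      open WalkD FL≢L

      ω≈π : ω ≈ π
      ω≈π = orbits-meet L⇝b (orbit-refl b)

      support⊆ : ∀ {x} → Support x → L ⇝ x
      support⊆ = [ (λ r → r) , orbit-trans L⇝b ]′

      L⇝c : L ⇝ c
      L⇝c = orbit-trans L⇝b (orbit-F b)

      c≢b : c ≢ b
      c≢b c≡b = FL≢L (fixed-on-orbit L⇝b c≡b)

      G-b : G b ≡ d
      G-b = trans (G-support b≢L (inj₂ (orbit-refl b))) (contractAt-b-moved FL≢L)

      -- Walking from d, b is reached before e: otherwise b would be a stop strictly inside the walk.
      y≡b : y ≡ b
      y≡b = [ (λ y≡b → y≡b) , (λ Fy≡L → [ ⊥-elim ∘ b≢L , on-walk ]′ (walk-covers-orbit Fy≡L L⇝b)) ]′ ends-at-b-or-e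
        where
        on-walk : Seg d j b → y ≡ b
        on-walk (i , i≤j , Fⁱd≡b) = [ (λ i<j → ⊥-elim (path i i<j (inj₂ (inj₁ Fⁱd≡b)))) , (λ { refl → Fⁱd≡b }) ]′
                                      (ℕ.m≤n⇒m<n∨m≡n i≤j)

      d⇝G : ∀ {x} → Seg d j x → d ⇝G x
      d⇝G = seg⇒⇝G (inj₁ (orbit-F L)) path

      G-fixes-only : ∀ {x} → x ≢ L → L ⇝ x → G x ≡ x → (x ≡ b × d ≡ b) ⊎ (x ≡ c × F c ≡ L)
      G-fixes-only {x} x≢L r Gx≡x = [ at-b , off-b ]′ (toSum (x ≟ b))
        where
        at-b : x ≡ b → (x ≡ b × d ≡ b) ⊎ (x ≡ c × F c ≡ L)
        at-b refl = inj₁ (refl , trans (sym G-b) Gx≡x)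
        off-b : x ≢ b → (x ≡ b × d ≡ b) ⊎ (x ≡ c × F c ≡ L)
        off-b x≢b = inj₂ (decidable-stable ((x ≟ c) ×-dec (F c ≟ L)) λ ¬at-c →
          G-moves-on-orbit FL≢L x≢L r x≢b (λ Fx≡L c≡x → ¬at-c (sym c≡x , subst (λ t → F t ≡ L) (sym c≡x) Fx≡L)) Gx≡x)

      ∣ω∣-split : (κ : Fin (suc m) → ℕ) → κ L ≡ 0 → (∀ x → ¬ L ⇝ x → κ x ≡ 0) →
                  (∀ x → G x ≢ x → κ x ≡ 0) → (∀ x → x ≢ L → L ⇝ x → G x ≡ x → κ x ≡ 1) →
                  ∣ ω ∣ ≡ ∣ χ ∣ + (1 + sum κ)
      ∣ω∣-split κ κL≡0 κ-off κ-moved κ-fixed = ∣ω∣-lost FL≢L support⊆ κ κL≡0 κ-off on-orbit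
        where
        on-orbit : ∀ x → x ≢ L → L ⇝ x → movedEmbed χ x + κ x ≡ 1
        on-orbit x x≢L r = [ (λ Gx≡x → cong₂ _+_ (differ-≡ Gx≡x) (κ-fixed x x≢L r Gx≡x))
                           , (λ Gx≢x → trans (cong₂ _+_ (differ-≢ Gx≢x) (κ-moved x Gx≢x)) refl) ]′ (toSum (G x ≟ x))

      module BIsE (Fb≡L : F b ≡ L) where

        Fy≡L : F y ≡ L
        Fy≡L = subst (λ t → F t ≡ L) (sym y≡b) Fb≡L

        not-c : ∀ {x} → x ≢ L → ¬ (x ≡ c × F c ≡ L)
        not-c x≢L (refl , _) = x≢L Fb≡L

        adjacent : d ≡ b → Outcome
        adjacent d≡b = outcome-merged 2 ω≈π (sym ∣ω∣≡∣χ∣+2) (ω≈π , isCycle-id χ (χ≈id G-fixes) , sym ∣ω∣≡∣χ∣+2)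
          where
          cover : ∀ {x} → L ⇝ x → x ≡ L ⊎ x ≡ b
          cover = orbit-induction (λ x → x ≡ L ⊎ x ≡ b) (inj₁ refl)
                    λ { y (inj₁ refl) → inj₂ d≡b ; y (inj₂ refl) → inj₁ Fb≡L }
          Gb≡b = trans G-b d≡b
          G-fixes : ∀ x → x ≢ L → G x ≡ x
          G-fixes x x≢L = [ (λ r → [ ⊥-elim ∘ x≢L , (λ { refl → Gb≡b }) ]′ (cover r))
                          , (λ ¬r → G-elsewhere x≢L (¬r ∘ support⊆)) ]′ (toSum (orbit? L x))
          ∣ω∣≡∣χ∣+2 : ∣ ω ∣ ≡ ∣ χ ∣ + 2
          ∣ω∣≡∣χ∣+2 = trans (∣ω∣-split (λ x → δ x b) (δ-≢ (b≢L ∘ sym)) (λ x ¬r → δ-≢ {x = x} λ { refl → ¬r L⇝b })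
                                      (λ x Gx≢x → δ-≢ {x = x} λ { refl → Gx≢x Gb≡b })
                                      (λ x x≢L r Gx≡x → [ δ-≡ ∘ proj₁ , ⊥-elim ∘ not-c x≢L ]′ (G-fixes-only x≢L r Gx≡x)))
                            (cong (λ t → ∣ χ ∣ + (1 + t)) (sum-δ b))

        distant : d ≢ b → Outcome
        distant d≢b =
          outcome-merged 1 ω≈π (sym ∣ω∣≡∣χ∣+1) (claim₁-merged ω≈π (inj₁ (isCycle-hub d FL≢L hub′ , sym ∣ω∣≡∣χ∣+1)))
          where
          hub′ : ∀ x → x ≢ L → G x ≢ x → d ⇝G x
          hub′ x x≢L Gx≢x = walk-hub Fy≡L x≢L (support⊆ (G-moves⇒support x≢L Gx≢x))
          ∣ω∣≡∣χ∣+1 : ∣ ω ∣ ≡ ∣ χ ∣ + 1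
          ∣ω∣≡∣χ∣+1 = trans (∣ω∣-split (λ _ → 0) refl (λ _ _ → refl) (λ _ _ → refl)
                                      (λ x x≢L r Gx≡x → [ ⊥-elim ∘ d≢b ∘ proj₂ , ⊥-elim ∘ not-c x≢L ]′ (G-fixes-only x≢L r Gx≡x)))
                            (cong (λ t → ∣ χ ∣ + (1 + t)) (sum-zero {suc m} (λ _ → refl)))

        outcome : Outcome
        outcome = [ adjacent , distant ]′ (toSum (d ≟ b))

      module BBeforeE (Fb≢L : F b ≢ L) where

        c≢L : c ≢ L
        c≢L = Fb≢L

        private
          walk-c = first-stop (orbit-sym L⇝c) (inj₁ refl)

        j′ : ℕ
        j′ = proj₁ walk-c

        path′ : Path c j′
        path′ = proj₂ (proj₂ walk-c)

        y′ : Fin (suc m)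
        y′ = iter F j′ c

        -- The walk from c cannot stop at b: the orbit of c would close up before reaching L.
        Fy′≡L : F y′ ≡ L
        Fy′≡L = [ (λ y′≡L → ⊥-elim (c≢L (path-to-L path′ y′≡L))) , [ ⊥-elim ∘ stops-at-b , (λ Fy′≡L → Fy′≡L) ]′ ]′
                  (proj₁ (proj₂ walk-c))
          where
          stops-at-b : y′ ≢ b
          stops-at-b y′≡b = L-off-walk (closed (orbit-sym L⇝c))
            where
            closed : ∀ {x} → c ⇝ x → Seg c j′ x
            closed = orbit-induction (Seg c j′) seg-start λ z seg →
              [ (λ { refl → subst (λ t → Seg c j′ (F t)) (sym y′≡b) seg-start }) , seg-step seg ]′ (toSum (z ≟ y′))
            L-off-walk : ¬ Seg c j′ L
            L-off-walk (i , i≤j′ , Fⁱc≡L) with ℕ.m≤n⇒m<n∨m≡n i≤j′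
            ... | inj₁ i<j′ = path′ i i<j′ (inj₁ Fⁱc≡L)
            ... | inj₂ refl = b≢L (trans (sym y′≡b) Fⁱc≡L)

        Gy′≡c : G y′ ≡ c
        Gy′≡c = trans (G-support (λ y′≡L → FL≢L (trans (cong F (sym y′≡L)) Fy′≡L)) (inj₁ (orbit-trans L⇝c (j′ , refl))))
                      (contractAt-into-last (λ y′≡b → Fb≢L (subst (λ t → F t ≡ L) y′≡b Fy′≡L)) Fy′≡L)

        c⇝G : ∀ {x} → Seg c j′ x → c ⇝G x
        c⇝G = seg⇒⇝G (inj₁ L⇝c) path′

        cover : ∀ {x} → L ⇝ x → x ≡ L ⊎ (Seg d j x ⊎ Seg c j′ x)
        cover = orbit-induction (λ x → x ≡ L ⊎ (Seg d j x ⊎ Seg c j′ x)) (inj₁ refl) step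
          where
          step : ∀ z → z ≡ L ⊎ (Seg d j z ⊎ Seg c j′ z) → F z ≡ L ⊎ (Seg d j (F z) ⊎ Seg c j′ (F z))
          step z (inj₁ refl)        = inj₂ (inj₁ seg-start)
          step z (inj₂ (inj₁ seg)) = [ (λ { refl → inj₂ (inj₂ (subst (λ t → Seg c j′ (F t)) (sym y≡b) seg-start)) })
                                     , inj₂ ∘ inj₁ ∘ seg-step seg ]′ (toSum (z ≟ y))
          step z (inj₂ (inj₂ seg)) = [ (λ { refl → inj₁ Fy′≡L }) , inj₂ ∘ inj₂ ∘ seg-step seg ]′ (toSum (z ≟ y′))

        moved-on-walks : ∀ {x} → x ≢ L → G x ≢ x → Seg d j x ⊎ Seg c j′ x
        moved-on-walks x≢L Gx≢x = [ ⊥-elim ∘ x≢L , (λ on-walks → on-walks) ]′ (cover (support⊆ (G-moves⇒support x≢L Gx≢x)))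

        Gc≡c : F c ≡ L → G c ≡ c
        Gc≡c Fc≡L = trans (G-support c≢L (inj₁ L⇝c)) (contractAt-into-last c≢b Fc≡L)

        Gb≡b : d ≡ b → G b ≡ b
        Gb≡b d≡b = trans G-b d≡b

        triangle : d ≡ b → F c ≡ L → Outcome
        triangle d≡b Fc≡L =
          outcome-merged 3 ω≈π (sym ∣ω∣≡∣χ∣+3) (ω≈π , trans ∣ω∣≡∣χ∣+3 (cong (_+ 3) (∣∣-id χ χ≈id′)) , χ≈id′)
          where
          cover₃ : ∀ {x} → L ⇝ x → x ≡ L ⊎ (x ≡ b ⊎ x ≡ c)
          cover₃ = orbit-induction (λ x → x ≡ L ⊎ (x ≡ b ⊎ x ≡ c)) (inj₁ refl)
            λ { y (inj₁ refl)        → inj₂ (inj₁ d≡b)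
              ; y (inj₂ (inj₁ refl)) → inj₂ (inj₂ refl)
              ; y (inj₂ (inj₂ refl)) → inj₁ Fc≡L }
          G-fixes : ∀ x → x ≢ L → G x ≡ x
          G-fixes x x≢L = [ (λ r → [ ⊥-elim ∘ x≢L , [ (λ { refl → Gb≡b d≡b }) , (λ { refl → Gc≡c Fc≡L }) ]′ ]′ (cover₃ r))
                          , (λ ¬r → G-elsewhere x≢L (¬r ∘ support⊆)) ]′ (toSum (orbit? L x))
          χ≈id′ : χ ≈ id
          χ≈id′ = χ≈id G-fixes
          ∣ω∣≡∣χ∣+3 : ∣ ω ∣ ≡ ∣ χ ∣ + 3
          ∣ω∣≡∣χ∣+3 = trans (∣ω∣-split (λ x → δ x b + δ x c) (cong₂ _+_ (δ-≢ (b≢L ∘ sym)) (δ-≢ (c≢L ∘ sym)))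
                               (λ x ¬r → cong₂ _+_ (δ-≢ {x = x} λ { refl → ¬r L⇝b }) (δ-≢ {x = x} λ { refl → ¬r L⇝c }))
                               (λ x Gx≢x → ⊥-elim (Gx≢x ([ (λ { refl → G-last }) , G-fixes x ]′ (toSum (x ≟ L)))))
                               (λ x x≢L r Gx≡x → [ (λ { (refl , _) → cong₂ _+_ (δ-≡ {x = b} refl) (δ-≢ (c≢b ∘ sym)) })
                                                 , (λ { (refl , _) → cong₂ _+_ (δ-≢ c≢b) (δ-≡ {x = c} refl) }) ]′ (G-fixes-only x≢L r Gx≡x)))
                            (cong (λ t → ∣ χ ∣ + (1 + t)) (sum-δ₂ b c))

        short-d : d ≡ b → F c ≢ L → Outcome
        short-d d≡b Fc≢L = outcome-merged 2 ω≈π (sym ∣ω∣≡∣χ∣+2) (ω≈π , isCycle-hub c c≢L hub′ , sym ∣ω∣≡∣χ∣+2)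
          where
          hub′ : ∀ x → x ≢ L → G x ≢ x → c ⇝G x
          hub′ x x≢L Gx≢x = [ (λ seg → ⊥-elim (Gx≢x (subst (λ t → G t ≡ t) (sym (x≡b seg)) (Gb≡b d≡b)))) , c⇝G ]′
                              (moved-on-walks x≢L Gx≢x)
            where
            x≡b : Seg d j x → x ≡ b
            x≡b seg = trans (seg-at-stop (inj₂ (inj₁ d≡b)) path seg) d≡b
          ∣ω∣≡∣χ∣+2 : ∣ ω ∣ ≡ ∣ χ ∣ + 2
          ∣ω∣≡∣χ∣+2 = trans (∣ω∣-split (λ x → δ x b) (δ-≢ (b≢L ∘ sym)) (λ x ¬r → δ-≢ {x = x} λ { refl → ¬r L⇝b })
                                      (λ x Gx≢x → δ-≢ {x = x} λ { refl → Gx≢x (Gb≡b d≡b) })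
                                      (λ x x≢L r Gx≡x → [ δ-≡ ∘ proj₁ , ⊥-elim ∘ Fc≢L ∘ proj₂ ]′ (G-fixes-only x≢L r Gx≡x)))
                            (cong (λ t → ∣ χ ∣ + (1 + t)) (sum-δ b))

        short-c : d ≢ b → F c ≡ L → Outcome
        short-c d≢b Fc≡L =
          outcome-merged 2 ω≈π (sym ∣ω∣≡∣χ∣+2) (ω≈π , isCycle-hub d FL≢L hub′ , sym ∣ω∣≡∣χ∣+2)
          where
          hub′ : ∀ x → x ≢ L → G x ≢ x → d ⇝G x
          hub′ x x≢L Gx≢x = [ d⇝G , (λ seg → ⊥-elim (Gx≢x (subst (λ t → G t ≡ t) (sym (x≡c seg)) (Gc≡c Fc≡L)))) ]′
                              (moved-on-walks x≢L Gx≢x)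
            where
            x≡c : Seg c j′ x → x ≡ c
            x≡c = seg-at-stop (inj₂ (inj₂ Fc≡L)) path′
          ∣ω∣≡∣χ∣+2 : ∣ ω ∣ ≡ ∣ χ ∣ + 2
          ∣ω∣≡∣χ∣+2 = trans (∣ω∣-split (λ x → δ x c) (δ-≢ (c≢L ∘ sym)) (λ x ¬r → δ-≢ {x = x} λ { refl → ¬r L⇝c })
                                      (λ x Gx≢x → δ-≢ {x = x} λ { refl → Gx≢x (Gc≡c Fc≡L) })
                                      (λ x x≢L r Gx≡x → [ ⊥-elim ∘ d≢b ∘ proj₂ , δ-≡ ∘ proj₁ ]′ (G-fixes-only x≢L r Gx≡x)))
                            (cong (λ t → ∣ χ ∣ + (1 + t)) (sum-δ c))

        two-cycles : d ≢ b → F c ≢ L → Outcome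
        two-cycles d≢b Fc≢L = outcome-merged 1 ω≈π (sym ∣ω∣≡∣χ∣+1)
          (claim₁-merged ω≈π (inj₂ (split (inject₁-onto d FL≢L) (inject₁-onto c c≢L))))
          where
          ∣ω∣≡∣χ∣+1 : ∣ ω ∣ ≡ ∣ χ ∣ + 1
          ∣ω∣≡∣χ∣+1 = trans (∣ω∣-split (λ _ → 0) refl (λ _ _ → refl) (λ _ _ → refl)
                                      (λ x x≢L r Gx≡x → [ ⊥-elim ∘ d≢b ∘ proj₂ , ⊥-elim ∘ Fc≢L ∘ proj₂ ]′ (G-fixes-only x≢L r Gx≡x)))
                            (cong (λ t → ∣ χ ∣ + (1 + t)) (sum-zero {suc m} (λ _ → refl)))
          G-preserves-walk-c : ∀ x → Seg c j′ x → Seg c j′ (G x)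
          G-preserves-walk-c x (i , i≤j′ , refl) with ℕ.m≤n⇒m<n∨m≡n i≤j′
          ... | inj₁ i<j′ = suc i , i<j′ , sym (G-off-stops (support-step i (inj₁ L⇝c)) (path′ i i<j′))
          ... | inj₂ refl = subst (Seg c j′) (sym Gy′≡c) seg-start
          d-off-walk-c : ¬ Seg c j′ d
          d-off-walk-c (zero  , _     , c≡d)    = b≢L (F-injective c≡d)
          d-off-walk-c (suc i , 1+i≤j′ , Fⁱ⁺¹c≡d) = path′ i 1+i≤j′ (inj₁ (F-injective Fⁱ⁺¹c≡d))
          split : (∃ λ d′ → inject₁ d′ ≡ d) → (∃ λ c′ → inject₁ c′ ≡ c) →
                  ProductOfTwoCycles χ (λ s → s + 1 ≡ ∣ ω ∣)
          split (d′ , d′≡d) (c′ , c′≡c) =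
            productOfTwoCycles-map {χ = χ} {P = _≡ ∣ χ ∣} (λ _ s≡∣χ∣ → trans (cong (_+ 1) s≡∣χ∣) (sym ∣ω∣≡∣χ∣+1))
              (Cycles.product-of-two-cycles χ d′ c′ ¬c′⇝d′ on-two-orbits)
            where
            ¬c′⇝d′ : ¬ InOrbit χ c′ d′
            ¬c′⇝d′ c′⇝d′ = d-off-walk-c (subst (Seg c j′) d′≡d
              (Orbit.orbit-induction χ (λ z → Seg c j′ (inject₁ z)) (subst (Seg c j′) (sym c′≡c) seg-start)
                 (λ z seg → subst (Seg c j′) (embed-inject₁ χ z) (G-preserves-walk-c _ seg)) c′⇝d′))
            on-two-orbits : ∀ z → Moves χ z → InOrbit χ d′ z ⊎ InOrbit χ c′ z
            on-two-orbits z χz≢z =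
              [ (λ seg → inj₁ (⇝G-orbit (subst (_⇝G inject₁ z) (sym d′≡d) (d⇝G seg))))
              , (λ seg → inj₂ (⇝G-orbit (subst (_⇝G inject₁ z) (sym c′≡c) (c⇝G seg)))) ]′
              (moved-on-walks (inject₁≢last z) (G-moves χz≢z))


        outcome : Outcome
        outcome = [ (λ d≡b → [ triangle d≡b , short-d d≡b ]′ (toSum (F c ≟ L)))
                  , (λ d≢b → [ short-c d≢b , two-cycles d≢b ]′ (toSum (F c ≟ L))) ]′ (toSum (d ≟ b))

      outcome : Outcome
      outcome = [ BIsE.outcome , BBeforeE.outcome ]′ (toSum (F b ≟ L))

    outcome : Outcome
    outcome = [ AtLast.outcome , (λ b≢L → [ Split.outcome b≢L , Apart.outcome ]′ (toSum (orbit? L b))) ]′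
                (toSum (b ≟ L))

proposition4p4 : ∀ {m : ℕ} (σ τ : S (suc m)) →
    ¬ (CT σ ≈ CT τ) →
    (ω π ρ : S (suc m)) →
    CycleOf (σ ⁻¹ · τ) last ω →
    CycleOf (σ ⁻¹ · τ) (σ ⟨$⟩ʳ last) π →
    (¬ (ω ≈ π) → σ ⁻¹ · τ ≈ ρ · ω · π) →
    (ω ≈ π → σ ⁻¹ · τ ≈ ρ · ω) →
    Disjoint ρ ω →
    Disjoint ρ π →
    ∃ λ (χ : S m) →
      (∀ y → embed (CT σ ⁻¹ · CT τ) y ≡ embed χ (ρ ⟨$⟩ʳ y))
      × (∀ y → embed χ y ≡ y ⊎ ρ ⟨$⟩ʳ y ≡ y)
      × (hd (CT σ) (CT τ) ≡ hd σ τ →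
           (ω ≈ id ⊎ π ≈ id) × IsCycle χ × ∣ χ ∣ ≡ ∣ ω · π ∣)
      × (hd (CT σ) (CT τ) + 1 ≡ hd σ τ →
           (ω ≈ π →
              (IsCycle χ × ∣ χ ∣ + 1 ≡ ∣ ω ∣)
              ⊎ (∃₂ λ (ω′ π′ : S m) → IsCycle ω′ × IsCycle π′ × Disjoint ω′ π′
                   × χ ≈ ω′ · π′ × ∣ ω′ ∣ + ∣ π′ ∣ + 1 ≡ ∣ ω ∣))
           × (¬ (ω ≈ π) → IsCycle χ × ∣ χ ∣ + 1 ≡ ∣ ω ∣ + ∣ π ∣))
      × (hd (CT σ) (CT τ) + 2 ≡ hd σ τ →
           ω ≈ π × IsCycle χ × ∣ χ ∣ + 2 ≡ ∣ ω ∣)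
      × (hd (CT σ) (CT τ) + 3 ≡ hd σ τ →
           ω ≈ π × ∣ ω ∣ ≡ 3 × χ ≈ id)
proposition4p4 σ τ _ ω π ρ ω-cycle π-cycle g≈ρωπ g≈ρω ρ#ω ρ#π =
  χ , conjugation , G#ρ , claim 0 ∘ trans (ℕ.+-identityʳ _) , claim 1 , claim 2 , claim 3
  where
  open Setting (σ ⁻¹ · τ) (σ ⟨$⟩ʳ last) ω π ρ ω-cycle π-cycle g≈ρωπ g≈ρω ρ#ω ρ#π
  open Contracted (CT σ ⁻¹ · CT τ) (contract-quotient σ τ)
  claim : ∀ j → hd (CT σ) (CT τ) + j ≡ hd σ τ → ClaimFor j
  claim j hd′+j≡hd = subst ClaimFor k≡j (proj₂ (proj₂ outcome))
    where
    k : ℕ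
    k = proj₁ outcome
    k≡j : k ≡ j
    k≡j = ℕ.+-cancelˡ-≡ (∣ CT σ ⁻¹ · CT τ ∣) k j (begin
      ∣ CT σ ⁻¹ · CT τ ∣ + k ≡⟨ proj₁ (proj₂ outcome) ⟩
      ∣ σ ⁻¹ · τ ∣           ≡⟨ hd≡∣σ⁻¹τ∣ σ τ ⟨
      hd σ τ                 ≡⟨ hd′+j≡hd ⟨
      hd (CT σ) (CT τ) + j   ≡⟨ cong (_+ j) (hd≡∣σ⁻¹τ∣ (CT σ) (CT τ)) ⟩
      ∣ CT σ ⁻¹ · CT τ ∣ + j ∎)
      where open ≡-Reasoning
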